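{- Let $n \geq 3$ be an integer. If $n \equiv 0 \pmod 3$, then $h(n,4)=n$. If $n \equiv 1$ or $2 \pmod 3$, then $h(n,4)=n+1$.
   Context: All graphs are finite and simple. A degree monotone path in a graph $G$ is a path $v_1v_2\ldots v_m$ such that $\deg(v_1)\le\cdots\le\deg(v_m)$ or $\deg(v_1)\ge\cdots\ge\deg(v_m)$, where degrees are taken in $G$. Its length is its number of vertices $m$. $mp(G)$ denotes the maximum length of a degree monotone path in $G$. For $k\ge 2$, a graph $G$ is called $k$-saturated if $mp(G)<k$ and $mp(G+e)\ge k$ for every edge $e$ joining two nonadjacent vertices of $G$, where $G+e$ is $G$ with $e$ added. In particular, every complete graph $K_m$ with $m\le k-1$ is $k$-saturated. $h(n,k)$ is the minimum number of edges of a $k$-saturated graph on $n$ vertices. -}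

module Defs where

open import Data.Bool using (Bool; true; false; _∧_; _∨_; if_then_else_)
open import Data.Nat using (ℕ; _≤_; _<_; _≥_; _<ᵇ_)
open import Data.Fin using (Fin; toℕ; _≟_)
open import Data.List using (List; length; filterᵇ; allFin; cartesianProduct)
open import Data.List.Relation.Unary.Unique.Propositional using (Unique)
open import Data.List.Relation.Unary.Linked using (Linked)
open import Data.Product using (Σ; _×_; _,_; ∃; proj₁; proj₂)
open import Data.Sum using (_⊎_)
open import Relation.Nullary using (¬_)
open import Relation.Nullary.Decidable using (⌊_⌋)
open import Relation.Binary.PropositionalEquality using (_≡_)

Graph : ℕ → Set
Graph n = Fin n → Fin n → Bool

IsSimple : ∀ {n} → Graph n → Set
IsSimple {n} G = (∀ (i j : Fin n) → G i j ≡ G j i) × (∀ (i : Fin n) → G i i ≡ false)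

deg : ∀ {n} → Graph n → Fin n → ℕ
deg {n} G i = length (filterᵇ (λ j → G i j) (allFin n))

edges : ∀ {n} → Graph n → ℕ
edges {n} G =
  length (filterᵇ (λ p → (toℕ (proj₁ p) <ᵇ toℕ (proj₂ p)) ∧ G (proj₁ p) (proj₂ p))
                  (cartesianProduct (allFin n) (allFin n)))

addEdge : ∀ {n} → Graph n → Fin n → Fin n → Graph n
addEdge G u v i j = G i j ∨ (⌊ i ≟ u ⌋ ∧ ⌊ j ≟ v ⌋) ∨ (⌊ i ≟ v ⌋ ∧ ⌊ j ≟ u ⌋)

IsPath : ∀ {n} → Graph n → List (Fin n) → Set
IsPath G p = Unique p × Linked (λ a b → G a b ≡ true) p

-- degree monotone path (degrees taken in G); its length is its number of vertices
IsDegMonotonePath : ∀ {n} → Graph n → List (Fin n) → Set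
IsDegMonotonePath G p =
  IsPath G p ×
  (Linked (λ a b → deg G a ≤ deg G b) p ⊎ Linked (λ a b → deg G a ≥ deg G b) p)

MpLess : ∀ {n} → Graph n → ℕ → Set
MpLess G k = ∀ p → IsDegMonotonePath G p → length p < k

MpAtLeast : ∀ {n} → Graph n → ℕ → Set
MpAtLeast G k = ∃ λ p → IsDegMonotonePath G p × k ≤ length p

IsSaturated : ∀ {n} → ℕ → Graph n → Set
IsSaturated {n} k G =
  IsSimple G × MpLess G k ×
  (∀ (u v : Fin n) → ¬ (u ≡ v) → G u v ≡ false → MpAtLeast (addEdge G u v) k)

IsH : ℕ → ℕ → ℕ → Set
IsH n k m =
  (Σ (Graph n) λ G → IsSaturated k G × edges G ≡ m) ×
  (∀ (G : Graph n) → IsSaturated k G → m ≤ edges G)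

module Submission where

-- mp(G) < 4 says that G has no degree monotone path on four vertices (Monotone4), so a
-- 4-saturated graph G has none, while every added edge uv creates one.  Lower bound:
-- adding a well chosen edge uv and locating the new monotone path (it must use uv when
-- u and v are safe, or it lies in a small closed configuration checked by evaluation)
-- shows that G has no isolated vertex and at most one leaf, that the neighbour of a leaf
-- is the unique vertex of maximum degree, and that the degree sum exceeds 2n unless G is
-- 2-regular (LowerBound).  A 2-regular such G is a disjoint union of triangles
-- (TwoRegular); the handshake lemma then gives at least n + 1 edges, or exactly n and
-- 3 ∣ n.  Upper bound: disjoint triangles, possibly together with K₄ minus an edge or
-- with two triangles sharing a vertex, are 4-saturated (Union, Construction).

open import Defs
open import Data.Bool using (Bool; true; false; _∧_; _∨_; not; if_then_else_; T)
open import Data.Bool.ListAction using (any)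
open import Data.Bool.Properties using (∨-comm; ∧-comm; ∨-identityʳ; ∨-zeroʳ; ∧-zeroʳ) renaming (_≟_ to _≟ᵇ_)
open import Data.Empty using (⊥; ⊥-elim)
open import Data.Fin using (Fin; zero; suc; toℕ; _≟_; _↑ˡ_; _↑ʳ_; #_; inject₁; splitAt; combine; quotient; remainder)
open import Data.Fin.Properties
  using (toℕ-injective; inject₁-injective; any?; splitAt-↑ˡ; splitAt-↑ʳ; splitAt⁻¹-↑ˡ; splitAt⁻¹-↑ʳ; ↑ˡ-injective; ↑ʳ-injective;
         remQuot-combine; combine-remQuot; combine-injectiveʳ)
open import Data.List using (List; []; _∷_; length; filterᵇ; allFin; tabulate; cartesianProduct; map; _++_)
open import Data.List.Membership.Propositional using (_∈_; _∉_)
open import Data.List.Relation.Unary.All using (All; []; _∷_) renaming (lookup to All-lookup)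
open import Data.List.Relation.Unary.All.Properties using (¬Any⇒All¬)
open import Data.List.Relation.Unary.AllPairs using ([]; _∷_)
open import Data.List.Relation.Unary.Any using (here; there)
open import Data.List.Relation.Unary.Linked using (Linked; []; [-]; _∷_)
open import Data.List.Relation.Unary.Unique.Propositional using (Unique)
open import Data.Nat using (ℕ; zero; suc; _≤_; _<_; _≥_; _+_; _*_; _%_; _/_; z≤n; s≤s; s≤s⁻¹; _<ᵇ_; _≤ᵇ_; _≡ᵇ_)
  renaming (_≟_ to _≟ℕ_)
open import Data.Nat.DivMod using (m*n%n≡0; m≡m%n+[m/n]*n; [m+n]%n≡m%n)
open import Data.Nat.Properties hiding (_≟_)
open import Algebra.Properties.CommutativeSemigroup +-commutativeSemigroup using (interchange)
open import Data.Product using (Σ; _×_; _,_; proj₁; proj₂)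
open import Data.Sum using (_⊎_; inj₁; inj₂; [_,_]′)
open import Data.Unit using (tt)
open import Function using (_∘_)
open import Relation.Nullary using (¬_; Dec; yes; no; ¬?)
open import Relation.Nullary.Decidable using (⌊_⌋; _×-dec_)
open import Relation.Binary.PropositionalEquality

module Counting where

  true≢false : true ≢ false
  true≢false ()

  T⇒≡ : ∀ {b} → T b → b ≡ true
  T⇒≡ {true} _ = refl

  ≡⇒T : ∀ {b} → b ≡ true → T b
  ≡⇒T refl = tt

  ind : Bool → ℕ
  ind true = 1
  ind false = 0

  ΣF : ∀ {n} → (Fin n → ℕ) → ℕ
  ΣF {zero} f = 0
  ΣF {suc n} f = f zero + ΣF (λ i → f (suc i))

  ΣF-ext : ∀ {n} {f g : Fin n → ℕ} → (∀ i → f i ≡ g i) → ΣF f ≡ ΣF g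
  ΣF-ext {zero} e = refl
  ΣF-ext {suc n} e = cong₂ _+_ (e zero) (ΣF-ext (λ i → e (suc i)))

  ΣF-+ : ∀ {n} (f g : Fin n → ℕ) → ΣF (λ i → f i + g i) ≡ ΣF f + ΣF g
  ΣF-+ {zero} f g = refl
  ΣF-+ {suc n} f g = trans (cong (f zero + g zero +_) (ΣF-+ (λ i → f (suc i)) (λ i → g (suc i))))
                           (interchange (f zero) (g zero) _ _)

  ΣF-mono : ∀ {n} {f g : Fin n → ℕ} → (∀ i → f i ≤ g i) → ΣF f ≤ ΣF g
  ΣF-mono {zero} e = z≤n
  ΣF-mono {suc n} e = +-mono-≤ (e zero) (ΣF-mono (λ i → e (suc i)))

  ΣF-const : ∀ n k → ΣF {n} (λ _ → k) ≡ n * k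
  ΣF-const zero k = refl
  ΣF-const (suc n) k = cong (k +_) (ΣF-const n k)

  ΣF-zero : ∀ {n} {f : Fin n → ℕ} → (∀ i → f i ≡ 0) → ΣF f ≡ 0
  ΣF-zero {n} h = trans (ΣF-ext h) (trans (ΣF-const n 0) (*-zeroʳ n))

  ΣF-swap : ∀ {n m} (f : Fin n → Fin m → ℕ) → ΣF (λ i → ΣF (λ j → f i j)) ≡ ΣF (λ j → ΣF (λ i → f i j))
  ΣF-swap {zero} {m} f = sym (ΣF-zero {m} (λ _ → refl))
  ΣF-swap {suc n} f = trans (cong (ΣF (f zero) +_) (ΣF-swap (λ i → f (suc i))))
                            (sym (ΣF-+ (f zero) (λ j → ΣF (λ i → f (suc i) j))))

  ΣF-split : ∀ g m (f : Fin (g + m) → ℕ) → ΣF f ≡ ΣF (λ k → f (k ↑ˡ m)) + ΣF (λ x → f (g ↑ʳ x))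
  ΣF-split zero m f = refl
  ΣF-split (suc g) m f = trans (cong (f zero +_) (ΣF-split g m (λ i → f (suc i)))) (sym (+-assoc (f zero) _ _))

  ΣF-point : ∀ {n} (a : Fin n) → ΣF (λ i → ind ⌊ i ≟ a ⌋) ≡ 1
  ΣF-point {suc n} zero = cong suc (ΣF-zero {n} (λ _ → refl))
  ΣF-point {suc n} (suc a) = trans (ΣF-ext {n} (λ i → cong ind (suc≟suc i))) (ΣF-point a)
    where
    suc≟suc : ∀ i → ⌊ suc i ≟ suc a ⌋ ≡ ⌊ i ≟ a ⌋
    suc≟suc i with i ≟ a
    ... | yes refl = refl
    ... | no _ = refl

  cnt : ∀ {n} → (Fin n → Bool) → ℕ
  cnt {n} f = length (filterᵇ f (allFin n))

  length-filter-tabulate : ∀ {A : Set} {n} (g : Fin n → A) (f : A → Bool) →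
    length (filterᵇ f (tabulate g)) ≡ ΣF (λ i → ind (f (g i)))
  length-filter-tabulate {n = zero} g f = refl
  length-filter-tabulate {n = suc n} g f with f (g zero)
  ... | true = cong suc (length-filter-tabulate (λ i → g (suc i)) f)
  ... | false = length-filter-tabulate (λ i → g (suc i)) f

  cnt≡ΣF : ∀ {n} (f : Fin n → Bool) → cnt f ≡ ΣF (λ i → ind (f i))
  cnt≡ΣF f = length-filter-tabulate (λ i → i) f

  cnt-ext : ∀ {n} {f g : Fin n → Bool} → (∀ i → f i ≡ g i) → cnt f ≡ cnt g
  cnt-ext {f = f} {g} e = trans (cnt≡ΣF f) (trans (ΣF-ext (λ i → cong ind (e i))) (sym (cnt≡ΣF g)))

  cnt-insert : ∀ {n} (a : Fin n) (f : Fin n → Bool) → f a ≡ false → cnt (λ j → f j ∨ ⌊ j ≟ a ⌋) ≡ suc (cnt f)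
  cnt-insert a f fa = begin
      cnt (λ j → f j ∨ ⌊ j ≟ a ⌋)                         ≡⟨ cnt≡ΣF (λ j → f j ∨ ⌊ j ≟ a ⌋) ⟩
      ΣF (λ j → ind (f j ∨ ⌊ j ≟ a ⌋))                     ≡⟨ ΣF-ext split ⟩
      ΣF (λ j → ind (f j) + ind ⌊ j ≟ a ⌋)                 ≡⟨ ΣF-+ (λ j → ind (f j)) (λ j → ind ⌊ j ≟ a ⌋) ⟩
      ΣF (λ j → ind (f j)) + ΣF (λ j → ind ⌊ j ≟ a ⌋)      ≡⟨ cong₂ _+_ (sym (cnt≡ΣF f)) (ΣF-point a) ⟩
      cnt f + 1                                            ≡⟨ +-comm (cnt f) 1 ⟩
      suc (cnt f)                                          ∎
    where
    open ≡-Reasoning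
    split : ∀ j → ind (f j ∨ ⌊ j ≟ a ⌋) ≡ ind (f j) + ind ⌊ j ≟ a ⌋
    split j with j ≟ a
    ... | yes refl rewrite fa = refl
    ... | no _ with f j
    ...   | true = refl
    ...   | false = refl

  _∈ᵇ_ : ∀ {n} → Fin n → List (Fin n) → Bool
  j ∈ᵇ [] = false
  j ∈ᵇ (x ∷ xs) = ⌊ j ≟ x ⌋ ∨ j ∈ᵇ xs

  ∈ᵇ⇒∈ : ∀ {n} {j : Fin n} xs → j ∈ᵇ xs ≡ true → j ∈ xs
  ∈ᵇ⇒∈ {j = j} (x ∷ xs) h with j ≟ x
  ... | yes p = here p
  ... | no _ = there (∈ᵇ⇒∈ xs h)

  ∈⇒∈ᵇ : ∀ {n} {j : Fin n} {xs} → j ∈ xs → j ∈ᵇ xs ≡ true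
  ∈⇒∈ᵇ {j = j} {x ∷ xs} (here p) with j ≟ x
  ... | yes _ = refl
  ... | no q = ⊥-elim (q p)
  ∈⇒∈ᵇ {j = j} {x ∷ xs} (there p) with j ≟ x
  ... | yes _ = refl
  ... | no _ = ∈⇒∈ᵇ p

  ΣF-members≤ : ∀ {n} (xs : List (Fin n)) → ΣF (λ j → ind (j ∈ᵇ xs)) ≤ length xs
  ΣF-members≤ {n} [] = ≤-reflexive (ΣF-zero {n} (λ _ → refl))
  ΣF-members≤ {n} (x ∷ xs) = begin
      ΣF (λ j → ind (⌊ j ≟ x ⌋ ∨ j ∈ᵇ xs))              ≤⟨ ΣF-mono ind-∨ ⟩
      ΣF (λ j → ind ⌊ j ≟ x ⌋ + ind (j ∈ᵇ xs))           ≡⟨ ΣF-+ {n} _ _ ⟩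
      ΣF (λ j → ind ⌊ j ≟ x ⌋) + ΣF (λ j → ind (j ∈ᵇ xs)) ≤⟨ +-mono-≤ (≤-reflexive (ΣF-point x)) (ΣF-members≤ xs) ⟩
      suc (length xs)                                    ∎
    where
    open ≤-Reasoning
    ind-∨ : ∀ j → ind (⌊ j ≟ x ⌋ ∨ j ∈ᵇ xs) ≤ ind ⌊ j ≟ x ⌋ + ind (j ∈ᵇ xs)
    ind-∨ j with ⌊ j ≟ x ⌋ | j ∈ᵇ xs
    ... | true | _ = s≤s z≤n
    ... | false | _ = ≤-refl

  ΣF-members : ∀ {n} {xs : List (Fin n)} → Unique xs → ΣF (λ j → ind (j ∈ᵇ xs)) ≡ length xs
  ΣF-members {n} {xs = []} [] = ΣF-zero {n} (λ _ → refl)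
  ΣF-members {n} {xs = x ∷ xs} (x∉xs ∷ u) = begin
      ΣF (λ j → ind (⌊ j ≟ x ⌋ ∨ j ∈ᵇ xs))              ≡⟨ ΣF-ext ind-∨ ⟩
      ΣF (λ j → ind ⌊ j ≟ x ⌋ + ind (j ∈ᵇ xs))           ≡⟨ ΣF-+ {n} _ _ ⟩
      ΣF (λ j → ind ⌊ j ≟ x ⌋) + ΣF (λ j → ind (j ∈ᵇ xs)) ≡⟨ cong₂ _+_ (ΣF-point x) (ΣF-members u) ⟩
      suc (length xs)                                    ∎
    where
    open ≡-Reasoning
    x∉ : x ∈ᵇ xs ≡ false
    x∉ with x ∈ᵇ xs in e
    ... | false = refl
    ... | true = ⊥-elim (All-lookup x∉xs (∈ᵇ⇒∈ xs e) refl)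
    ind-∨ : ∀ j → ind (⌊ j ≟ x ⌋ ∨ j ∈ᵇ xs) ≡ ind ⌊ j ≟ x ⌋ + ind (j ∈ᵇ xs)
    ind-∨ j with j ≟ x
    ... | yes refl rewrite x∉ = refl
    ... | no _ = refl

  search : ∀ {n} (f : Fin n → Bool) → (Σ (Fin n) λ j → f j ≡ true) ⊎ (∀ j → f j ≡ false)
  search {zero} f = inj₂ (λ ())
  search {suc n} f with f zero in e
  ... | true = inj₁ (zero , e)
  ... | false with search (λ i → f (suc i))
  ...   | inj₁ (j , p) = inj₁ (suc j , p)
  ...   | inj₂ h = inj₂ λ { zero → e ; (suc j) → h j }

  module _ {n} (f : Fin n → Bool) where

    distinct≤cnt : ∀ {xs} → Unique xs → All (λ x → f x ≡ true) xs → length xs ≤ cnt f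
    distinct≤cnt {xs} u all = begin
        length xs                  ≡⟨ sym (ΣF-members u) ⟩
        ΣF (λ j → ind (j ∈ᵇ xs))    ≤⟨ ΣF-mono pointwise ⟩
        ΣF (λ j → ind (f j))        ≡⟨ sym (cnt≡ΣF f) ⟩
        cnt f                      ∎
      where
      open ≤-Reasoning
      pointwise : ∀ j → ind (j ∈ᵇ xs) ≤ ind (f j)
      pointwise j with j ∈ᵇ xs in e
      ... | false = z≤n
      ... | true rewrite All-lookup all (∈ᵇ⇒∈ xs e) = ≤-refl

    cnt≤length : ∀ {xs} → (∀ j → f j ≡ true → j ∈ xs) → cnt f ≤ length xs
    cnt≤length {xs} within = begin
        cnt f                      ≡⟨ cnt≡ΣF f ⟩
        ΣF (λ j → ind (f j))        ≤⟨ ΣF-mono pointwise ⟩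
        ΣF (λ j → ind (j ∈ᵇ xs))    ≤⟨ ΣF-members≤ xs ⟩
        length xs                  ∎
      where
      open ≤-Reasoning
      pointwise : ∀ j → ind (f j) ≤ ind (j ∈ᵇ xs)
      pointwise j with f j in e
      ... | false = z≤n
      ... | true rewrite ∈⇒∈ᵇ (within j e) = ≤-refl

    only-within : ∀ {xs} → cnt f ≤ length xs → Unique xs → All (λ x → f x ≡ true) xs →
      ∀ {t} → f t ≡ true → t ∈ xs
    only-within {xs} le u all {t} ft with t ∈ᵇ xs in e
    ... | true = ∈ᵇ⇒∈ xs e
    ... | false = ⊥-elim (<⇒≱ (distinct≤cnt (¬Any⇒All¬ xs t∉xs ∷ u) (ft ∷ all)) le)
      where
      t∉xs : t ∉ xs
      t∉xs t∈xs = true≢false (trans (sym (∈⇒∈ᵇ t∈xs)) e)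

    outside : ∀ xs → length xs < cnt f → Σ (Fin n) λ j → f j ≡ true × j ∉ xs
    outside xs gt with search (λ j → f j ∧ not (j ∈ᵇ xs))
    ... | inj₁ (j , p) = j , fits p
      where
      fits : f j ∧ not (j ∈ᵇ xs) ≡ true → f j ≡ true × j ∉ xs
      fits h with f j | j ∈ᵇ xs in e
      ... | true | false = refl , λ j∈xs → true≢false (trans (sym (∈⇒∈ᵇ j∈xs)) e)
    ... | inj₂ none = ⊥-elim (<⇒≱ gt (cnt≤length within))
      where
      within : ∀ j → f j ≡ true → j ∈ xs
      within j fj with none j
      ... | h rewrite fj with j ∈ᵇ xs in e
      ...   | true = ∈ᵇ⇒∈ xs e

    cnt≥1 : ∀ {y} → f y ≡ true → 1 ≤ cnt f
    cnt≥1 fy = distinct≤cnt ([] ∷ []) (fy ∷ [])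

    cnt≥2 : ∀ {y z} → f y ≡ true → f z ≡ true → y ≢ z → 2 ≤ cnt f
    cnt≥2 fy fz y≢z = distinct≤cnt ((y≢z ∷ []) ∷ [] ∷ []) (fy ∷ fz ∷ [])

    only1 : cnt f ≤ 1 → ∀ {y} → f y ≡ true → ∀ {t} → f t ≡ true → t ≡ y
    only1 le fy ft with only-within le ([] ∷ []) (fy ∷ []) ft
    ... | here p = p

    only2 : cnt f ≤ 2 → ∀ {y z} → f y ≡ true → f z ≡ true → y ≢ z → ∀ {t} → f t ≡ true → t ≡ y ⊎ t ≡ z
    only2 le fy fz y≢z ft with only-within le ((y≢z ∷ []) ∷ [] ∷ []) (fy ∷ fz ∷ []) ft
    ... | here p = inj₁ p
    ... | there (here p) = inj₂ p

    only3 : cnt f ≤ 3 → ∀ {y z s} → f y ≡ true → f z ≡ true → f s ≡ true → y ≢ z → y ≢ s → z ≢ s →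
      ∀ {t} → f t ≡ true → t ≡ y ⊎ t ≡ z ⊎ t ≡ s
    only3 le fy fz fs y≢z y≢s z≢s ft with only-within le ((y≢z ∷ y≢s ∷ []) ∷ (z≢s ∷ []) ∷ [] ∷ []) (fy ∷ fz ∷ fs ∷ []) ft
    ... | here p = inj₁ p
    ... | there (here p) = inj₂ (inj₁ p)
    ... | there (there (here p)) = inj₂ (inj₂ p)

    witness : 1 ≤ cnt f → Σ (Fin n) λ j → f j ≡ true
    witness gt with outside [] gt
    ... | j , fj , _ = j , fj

    another : ∀ y → 2 ≤ cnt f → Σ (Fin n) λ j → f j ≡ true × j ≢ y
    another y gt with outside (y ∷ []) gt
    ... | j , fj , j∉ = j , fj , λ e → j∉ (here e)

    third : ∀ y z → 3 ≤ cnt f → Σ (Fin n) λ j → f j ≡ true × j ≢ y × j ≢ z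
    third y z gt with outside (y ∷ z ∷ []) gt
    ... | j , fj , j∉ = j , fj , (λ e → j∉ (here e)) , (λ e → j∉ (there (here e)))

  argmax : ∀ {n} (P : Fin n → Bool) (f : Fin n → ℕ) →
    (∀ z → P z ≡ false) ⊎ (Σ (Fin n) λ m → P m ≡ true × (∀ z → P z ≡ true → f z ≤ f m))
  argmax {zero} P f = inj₁ (λ ())
  argmax {suc n} P f with argmax (λ i → P (suc i)) (λ i → f (suc i)) | P zero in e0
  ... | inj₁ h | false = inj₁ λ { zero → e0 ; (suc z) → h z }
  ... | inj₁ h | true = inj₂ (zero , e0 , λ { zero _ → ≤-refl ; (suc z) p → ⊥-elim (true≢false (trans (sym p) (h z))) })
  ... | inj₂ (m , pm , hm) | false = inj₂ (suc m , pm , λ { zero p → ⊥-elim (true≢false (trans (sym p) e0)) ; (suc z) p → hm z p })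
  ... | inj₂ (m , pm , hm) | true with f zero ≤? f (suc m)
  ...   | yes le = inj₂ (suc m , pm , λ { zero _ → le ; (suc z) p → hm z p })
  ...   | no gt = inj₂ (zero , e0 , λ { zero _ → ≤-refl ; (suc z) p → ≤-trans (hm z p) (≰⇒≥ gt) })

  max-outside : ∀ {n} (f : Fin n → ℕ) (S : List (Fin n)) {z} → z ∉ S →
    Σ (Fin n) λ m → m ∉ S × (∀ y → y ∉ S → f y ≤ f m)
  max-outside f S {z} z∉S with argmax (λ y → not (y ∈ᵇ S)) f
  ... | inj₁ none = ⊥-elim (z∉S (∈ᵇ⇒∈ S (not-false (none z))))
    where not-false : ∀ {b} → not b ≡ false → b ≡ true
          not-false {true} _ = refl
  ... | inj₂ (m , pm , hm) = m , m∉S , λ y y∉S → hm y (∉⇒not y∉S)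
    where
    ∉⇒not : ∀ {y} → y ∉ S → not (y ∈ᵇ S) ≡ true
    ∉⇒not {y} y∉S with y ∈ᵇ S in e
    ... | false = refl
    ... | true = ⊥-elim (y∉S (∈ᵇ⇒∈ S e))
    m∉S : m ∉ S
    m∉S m∈S = true≢false (trans (sym pm) (cong not (∈⇒∈ᵇ m∈S)))

  ΣF-lower : ∀ {n} {f e : Fin n → ℕ} → (∀ i → 2 + e i ≤ f i) → n * 2 + ΣF e ≤ ΣF f
  ΣF-lower {n} {f} {e} h = begin
      n * 2 + ΣF e                ≡⟨ cong (_+ ΣF e) (sym (ΣF-const n 2)) ⟩
      ΣF {n} (λ _ → 2) + ΣF e     ≡⟨ sym (ΣF-+ (λ _ → 2) e) ⟩
      ΣF (λ i → 2 + e i)          ≤⟨ ΣF-mono h ⟩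
      ΣF f                        ∎
    where open ≤-Reasoning

  ≟-comm : ∀ {n} (a b : Fin n) → ⌊ a ≟ b ⌋ ≡ ⌊ b ≟ a ⌋
  ≟-comm a b with a ≟ b | b ≟ a
  ... | yes _ | yes _ = refl
  ... | no _ | no _ = refl
  ... | yes p | no q = ⊥-elim (q (sym p))
  ... | no p | yes q = ⊥-elim (p (sym q))

  twice : ∀ m → m * 2 ≡ m + m
  twice m = trans (*-comm m 2) (cong (m +_) (+-identityʳ m))

  double-injective : ∀ {m n} → m + m ≡ n + n → m ≡ n
  double-injective {m} {n} e =
    *-cancelˡ-≡ m n 2 (trans (cong (m +_) (+-identityʳ m)) (trans e (cong (n +_) (sym (+-identityʳ n)))))

  half< : ∀ {m e} → m * 2 < e + e → m < e
  half< {m} {e} h = ≰⇒> λ e≤m → <⇒≱ h (subst (e + e ≤_) (sym (twice m)) (+-mono-≤ e≤m e≤m))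

module MonotonePaths where

  open Counting using (cnt-ext)

  Mono : ∀ {n} → (Fin n → ℕ) → Fin n → Fin n → Fin n → Fin n → Set
  Mono f a b c d = (f a ≤ f b × f b ≤ f c × f c ≤ f d) ⊎ (f b ≤ f a × f c ≤ f b × f d ≤ f c)

  -- Since a degree
  -- monotone path of length ≥ 4 begins with one of length exactly 4, mp(G) < 4
  -- says precisely that G has no such path.
  record Monotone4 {n} (G : Graph n) (a b c d : Fin n) : Set where
    constructor mkMonotone4
    field
      dab : a ≢ b
      dac : a ≢ c
      dad : a ≢ d
      dbc : b ≢ c
      dbd : b ≢ d
      dcd : c ≢ d
      eab : G a b ≡ true
      ebc : G b c ≡ true
      ecd : G c d ≡ true
      mono : Mono (deg G) a b c d

  NoMonotone4 : ∀ {n} → Graph n → Set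
  NoMonotone4 {n} G = ∀ (a b c d : Fin n) → ¬ Monotone4 G a b c d

  HasMonotone4 : ∀ {n} → Graph n → Set
  HasMonotone4 {n} G = Σ (Fin n) λ a → Σ (Fin n) λ b → Σ (Fin n) λ c → Σ (Fin n) λ d → Monotone4 G a b c d

  Sym : ∀ {n} → Graph n → Set
  Sym {n} G = ∀ (i j : Fin n) → G i j ≡ G j i

  reverse4 : ∀ {n} {G : Graph n} {a b c d} → Sym G → Monotone4 G a b c d → Monotone4 G d c b a
  reverse4 {G = G} {a} {b} {c} {d} s (mkMonotone4 dab dac dad dbc dbd dcd eab ebc ecd mono) =
    mkMonotone4 (≢-sym dcd) (≢-sym dbd) (≢-sym dad) (≢-sym dbc) (≢-sym dac) (≢-sym dab)
                (trans (s d c) ecd) (trans (s c b) ebc) (trans (s b a) eab) flipped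
    where
    flipped : Mono (deg G) d c b a
    flipped = [ (λ { (x , y , z) → inj₂ (z , y , x) }) , (λ { (x , y , z) → inj₁ (z , y , x) }) ]′ mono

  Monotone4⇒mp≥4 : ∀ {n} {G : Graph n} {a b c d} → Monotone4 G a b c d → MpAtLeast G 4
  Monotone4⇒mp≥4 {G = G} {a} {b} {c} {d} (mkMonotone4 dab dac dad dbc dbd dcd eab ebc ecd mono) =
    (a ∷ b ∷ c ∷ d ∷ []) ,
    ((((dab ∷ dac ∷ dad ∷ []) ∷ (dbc ∷ dbd ∷ []) ∷ (dcd ∷ []) ∷ [] ∷ []) , (eab ∷ ebc ∷ ecd ∷ [-])) , linked) ,
    s≤s (s≤s (s≤s (s≤s z≤n)))
    where
    linked : Linked (λ x y → deg G x ≤ deg G y) (a ∷ b ∷ c ∷ d ∷ []) ⊎ Linked (λ x y → deg G x ≥ deg G y) (a ∷ b ∷ c ∷ d ∷ [])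
    linked = [ (λ { (x , y , z) → inj₁ (x ∷ y ∷ z ∷ [-]) }) , (λ { (x , y , z) → inj₂ (x ∷ y ∷ z ∷ [-]) }) ]′ mono

  prefix4 : ∀ {n} {G : Graph n} a b c d rest → IsDegMonotonePath G (a ∷ b ∷ c ∷ d ∷ rest) → Monotone4 G a b c d
  prefix4 {G = G} a b c d rest ((((dab ∷ dac ∷ dad ∷ _) ∷ (dbc ∷ dbd ∷ _) ∷ (dcd ∷ _) ∷ _) , (eab ∷ ebc ∷ ecd ∷ _)) , linked) =
    mkMonotone4 dab dac dad dbc dbd dcd eab ebc ecd (mono linked)
    where
    mono : Linked (λ x y → deg G x ≤ deg G y) (a ∷ b ∷ c ∷ d ∷ rest) ⊎ Linked (λ x y → deg G x ≥ deg G y) (a ∷ b ∷ c ∷ d ∷ rest) →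
           Mono (deg G) a b c d
    mono (inj₁ (x ∷ y ∷ z ∷ _)) = inj₁ (x , y , z)
    mono (inj₂ (x ∷ y ∷ z ∷ _)) = inj₂ (x , y , z)

  mp≥4⇒Monotone4 : ∀ {n} {G : Graph n} → MpAtLeast G 4 → HasMonotone4 G
  mp≥4⇒Monotone4 ((a ∷ b ∷ c ∷ d ∷ rest) , p , _) = a , b , c , d , prefix4 a b c d rest p
  mp≥4⇒Monotone4 ([] , p , ())
  mp≥4⇒Monotone4 ((_ ∷ []) , p , s≤s ())
  mp≥4⇒Monotone4 ((_ ∷ _ ∷ []) , p , s≤s (s≤s ()))
  mp≥4⇒Monotone4 ((_ ∷ _ ∷ _ ∷ []) , p , s≤s (s≤s (s≤s ())))

  NoMonotone4⇒mp<4 : ∀ {n} {G : Graph n} → NoMonotone4 G → MpLess G 4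
  NoMonotone4⇒mp<4 none [] _ = s≤s z≤n
  NoMonotone4⇒mp<4 none (_ ∷ []) _ = s≤s (s≤s z≤n)
  NoMonotone4⇒mp<4 none (_ ∷ _ ∷ []) _ = s≤s (s≤s (s≤s z≤n))
  NoMonotone4⇒mp<4 none (_ ∷ _ ∷ _ ∷ []) _ = s≤s (s≤s (s≤s (s≤s z≤n)))
  NoMonotone4⇒mp<4 none (a ∷ b ∷ c ∷ d ∷ rest) p = ⊥-elim (none a b c d (prefix4 a b c d rest p))

  mp<4⇒NoMonotone4 : ∀ {n} {G : Graph n} → MpLess G 4 → NoMonotone4 G
  mp<4⇒NoMonotone4 less a b c d path with less _ (proj₁ (proj₂ (Monotone4⇒mp≥4 path)))
  ... | s≤s (s≤s (s≤s (s≤s ())))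

  pullback4 : ∀ {m n} {A : Graph m} {H : Graph n} (f : Fin m → Fin n) → (∀ {i j} → f i ≡ f j → i ≡ j) →
    (∀ i j → H (f i) (f j) ≡ true → A i j ≡ true) → (∀ i → deg H (f i) ≡ deg A i) →
    ∀ {a b c d} → Monotone4 H (f a) (f b) (f c) (f d) → Monotone4 A a b c d
  pullback4 {A = A} {H} f inj adj degs {a} {b} {c} {d} (mkMonotone4 dab dac dad dbc dbd dcd eab ebc ecd mono) =
    mkMonotone4 (ne dab) (ne dac) (ne dad) (ne dbc) (ne dbd) (ne dcd) (adj a b eab) (adj b c ebc) (adj c d ecd)
      ([ (λ { (x , y , z) → inj₁ (le x , le y , le z) }) , (λ { (x , y , z) → inj₂ (le x , le y , le z) }) ]′ mono)
    where
    ne : ∀ {i j} → f i ≢ f j → i ≢ j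
    ne p refl = p refl
    le : ∀ {i j} → deg H (f i) ≤ deg H (f j) → deg A i ≤ deg A j
    le {i} {j} = subst₂ _≤_ (degs i) (degs j)

  pushforward4 : ∀ {m n} {A : Graph m} {H : Graph n} (f : Fin m → Fin n) → (∀ {i j} → f i ≡ f j → i ≡ j) →
    (∀ i j → A i j ≡ true → H (f i) (f j) ≡ true) → (∀ i → deg H (f i) ≡ deg A i) →
    ∀ {a b c d} → Monotone4 A a b c d → Monotone4 H (f a) (f b) (f c) (f d)
  pushforward4 {A = A} {H} f inj adj degs {a} {b} {c} {d} (mkMonotone4 dab dac dad dbc dbd dcd eab ebc ecd mono) =
    mkMonotone4 (ne dab) (ne dac) (ne dad) (ne dbc) (ne dbd) (ne dcd) (adj a b eab) (adj b c ebc) (adj c d ecd)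
      ([ (λ { (x , y , z) → inj₁ (le x , le y , le z) }) , (λ { (x , y , z) → inj₂ (le x , le y , le z) }) ]′ mono)
    where
    ne : ∀ {i j} → i ≢ j → f i ≢ f j
    ne p e = p (inj e)
    le : ∀ {i j} → deg A i ≤ deg A j → deg H (f i) ≤ deg H (f j)
    le {i} {j} = subst₂ _≤_ (sym (degs i)) (sym (degs j))

  Monotone4-ext : ∀ {n} {H H' : Graph n} → (∀ x y → H x y ≡ H' x y) → ∀ {a b c d} → Monotone4 H a b c d → Monotone4 H' a b c d
  Monotone4-ext {H = H} {H'} e = pushforward4 (λ x → x) (λ p → p) (λ x y h → trans (sym (e x y)) h) (λ x → sym (cnt-ext (e x)))

  Saturated4 : ∀ {n} → Graph n → Set
  Saturated4 {n} G = ∀ u v → u ≢ v → G u v ≡ false → HasMonotone4 (addEdge G u v)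

  IsSaturated⇒ : ∀ {n} {G : Graph n} → IsSaturated 4 G → IsSimple G × NoMonotone4 G × Saturated4 G
  IsSaturated⇒ (sG , less , sat) = sG , mp<4⇒NoMonotone4 less , λ u v u≢v guv → mp≥4⇒Monotone4 (sat u v u≢v guv)

  ⇒IsSaturated : ∀ {n} {G : Graph n} → IsSimple G → NoMonotone4 G → Saturated4 G → IsSaturated 4 G
  ⇒IsSaturated sG none sat = sG , NoMonotone4⇒mp<4 none , λ u v u≢v guv → path (sat u v u≢v guv)
    where
    path : ∀ {H} → HasMonotone4 H → MpAtLeast H 4
    path (_ , _ , _ , _ , p) = Monotone4⇒mp≥4 p

module AddEdge where

  open Counting
  open MonotonePaths

  addEdge-sym : ∀ {n} (G : Graph n) u v → Sym G → Sym (addEdge G u v)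
  addEdge-sym G u v s x y =
    cong₂ _∨_ (s x y) (trans (∨-comm (⌊ x ≟ u ⌋ ∧ ⌊ y ≟ v ⌋) _)
                             (cong₂ _∨_ (∧-comm ⌊ x ≟ v ⌋ ⌊ y ≟ u ⌋) (∧-comm ⌊ x ≟ u ⌋ ⌊ y ≟ v ⌋)))

  addEdge-comm : ∀ {n} (G : Graph n) u v x y → addEdge G u v x y ≡ addEdge G v u x y
  addEdge-comm G u v x y = cong (G x y ∨_) (∨-comm (⌊ x ≟ u ⌋ ∧ ⌊ y ≟ v ⌋) (⌊ x ≟ v ⌋ ∧ ⌊ y ≟ u ⌋))

  module Extend {n} (G : Graph n) (sG : IsSimple G) (u v : Fin n) (u≢v : u ≢ v) (guv : G u v ≡ false) where

    H : Graph n
    H = addEdge G u v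

    NewEdge : Fin n → Fin n → Set
    NewEdge x y = (x ≡ u × y ≡ v) ⊎ (x ≡ v × y ≡ u)

    newEdge? : ∀ x y → Dec (NewEdge x y)
    newEdge? x y with x ≟ u | y ≟ v | x ≟ v | y ≟ u
    ... | yes p | yes q | _ | _ = yes (inj₁ (p , q))
    ... | _ | _ | yes p | yes q = yes (inj₂ (p , q))
    ... | no p | _ | no r | _ = no λ { (inj₁ (a , _)) → p a ; (inj₂ (a , _)) → r a }
    ... | no p | _ | yes _ | no s = no λ { (inj₁ (a , _)) → p a ; (inj₂ (_ , b)) → s b }
    ... | yes _ | no q | no r | _ = no λ { (inj₁ (_ , b)) → q b ; (inj₂ (a , _)) → r a }
    ... | yes _ | no q | yes _ | no s = no λ { (inj₁ (_ , b)) → q b ; (inj₂ (_ , b)) → s b }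

    newEdge-sym : ∀ {x y} → NewEdge x y → NewEdge y x
    newEdge-sym (inj₁ (a , b)) = inj₂ (b , a)
    newEdge-sym (inj₂ (a , b)) = inj₁ (b , a)

    H-sym : Sym H
    H-sym = addEdge-sym G u v (proj₁ sG)

    G⊆H : ∀ x y → G x y ≡ true → H x y ≡ true
    G⊆H x y g rewrite g = refl

    H-uv : H u v ≡ true
    H-uv with u ≟ u | v ≟ v
    ... | yes _ | yes _ = ∨-zeroʳ (G u v)
    ... | no p | _ = ⊥-elim (p refl)
    ... | yes _ | no p = ⊥-elim (p refl)

    H-vu : H v u ≡ true
    H-vu = trans (H-sym v u) H-uv

    H⊆G∪new : ∀ x y → H x y ≡ true → G x y ≡ true ⊎ NewEdge x y
    H⊆G∪new x y h with G x y | x ≟ u | y ≟ v | x ≟ v | y ≟ u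
    ... | true | _ | _ | _ | _ = inj₁ refl
    ... | false | yes p | yes q | _ | _ = inj₂ (inj₁ (p , q))
    ... | false | _ | _ | yes p | yes q = inj₂ (inj₂ (p , q))
    ... | false | no _ | _ | no _ | _ = ⊥-elim (true≢false (sym h))
    ... | false | no _ | _ | yes _ | no _ = ⊥-elim (true≢false (sym h))
    ... | false | yes _ | no _ | no _ | _ = ⊥-elim (true≢false (sym h))
    ... | false | yes _ | no _ | yes _ | no _ = ⊥-elim (true≢false (sym h))

    H⊆G : ∀ x y → H x y ≡ true → ¬ NewEdge x y → G x y ≡ true
    H⊆G x y h new = [ (λ g → g) , (λ e → ⊥-elim (new e)) ]′ (H⊆G∪new x y h)

    nbr-u : ∀ y → H u y ≡ true → G u y ≡ true ⊎ y ≡ v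
    nbr-u y h with H⊆G∪new u y h
    ... | inj₁ g = inj₁ g
    ... | inj₂ (inj₁ (_ , q)) = inj₂ q
    ... | inj₂ (inj₂ (p , _)) = ⊥-elim (u≢v p)

    nbr-v : ∀ y → H v y ≡ true → G v y ≡ true ⊎ y ≡ u
    nbr-v y h with H⊆G∪new v y h
    ... | inj₁ g = inj₁ g
    ... | inj₂ (inj₁ (p , _)) = ⊥-elim (u≢v (sym p))
    ... | inj₂ (inj₂ (_ , q)) = inj₂ q

    nbr-other : ∀ x y → x ≢ u → x ≢ v → H x y ≡ true → G x y ≡ true
    nbr-other x y xu xv h = H⊆G x y h λ { (inj₁ (p , _)) → xu p ; (inj₂ (p , _)) → xv p }

    deg-u : deg H u ≡ suc (deg G u)
    deg-u = trans (cnt-ext row) (cnt-insert v (G u) guv)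
      where
      row : ∀ j → H u j ≡ G u j ∨ ⌊ j ≟ v ⌋
      row j with u ≟ u | u ≟ v
      ... | no p | _ = ⊥-elim (p refl)
      ... | yes _ | yes p = ⊥-elim (u≢v p)
      ... | yes _ | no _ = cong (G u j ∨_) (∨-identityʳ ⌊ j ≟ v ⌋)

    deg-v : deg H v ≡ suc (deg G v)
    deg-v = trans (cnt-ext row) (cnt-insert u (G v) (trans (proj₁ sG v u) guv))
      where
      row : ∀ j → H v j ≡ G v j ∨ ⌊ j ≟ u ⌋
      row j with v ≟ u | v ≟ v
      ... | yes p | _ = ⊥-elim (u≢v (sym p))
      ... | no _ | no p = ⊥-elim (p refl)
      ... | no _ | yes _ = refl

    deg-other : ∀ x → x ≢ u → x ≢ v → deg H x ≡ deg G x
    deg-other x xu xv = cnt-ext row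
      where
      row : ∀ j → H x j ≡ G x j
      row j with x ≟ u | x ≟ v
      ... | yes p | _ = ⊥-elim (xu p)
      ... | no _ | yes p = ⊥-elim (xv p)
      ... | no _ | no _ = ∨-identityʳ (G x j)

    Position : Fin n → Set
    Position x = (x ≡ u) ⊎ (x ≡ v) ⊎ (x ≢ u × x ≢ v)

    position : ∀ x → Position x
    position x with x ≟ u | x ≟ v
    ... | yes p | _ = inj₁ p
    ... | no _ | yes p = inj₂ (inj₁ p)
    ... | no p | no q = inj₂ (inj₂ (p , q))

module NewPaths where

  open MonotonePaths
  open AddEdge

  -- x is safe in G when no neighbour of x has degree exactly deg x + 1.  Adding an
  -- edge at a safe vertex raises its degree by one without making it equal to, or
  -- overtaking, the degree of any neighbour it was below.
  Safe : ∀ {n} → Graph n → Fin n → Set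
  Safe {n} G x = ∀ y → G x y ≡ true → deg G y ≢ suc (deg G x)

  -- The four ways a degree monotone path on four vertices can use the edge uv
  -- (up to reversal): starting with uv, starting with vu, or having uv or vu in the middle.
  NewPath : ∀ {n} → Graph n → Fin n → Fin n → Set
  NewPath {n} H u v =
      (Σ (Fin n) λ c → Σ (Fin n) λ d → Monotone4 H u v c d)
    ⊎ (Σ (Fin n) λ c → Σ (Fin n) λ d → Monotone4 H v u c d)
    ⊎ (Σ (Fin n) λ a → Σ (Fin n) λ d → Monotone4 H a u v d)
    ⊎ (Σ (Fin n) λ a → Σ (Fin n) λ d → Monotone4 H a v u d)

  module ViaNewEdge {n} (G : Graph n) (sG : IsSimple G) (u v : Fin n) (u≢v : u ≢ v) (guv : G u v ≡ false) where
    open Extend G sG u v u≢v guv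

    Other : Fin n → Set
    Other x = x ≢ u × x ≢ v

    other-deg : ∀ {x} → Other x → deg H x ≡ deg G x
    other-deg {x} (xu , xv) = deg-other x xu xv

    old-edge-order : Safe G u → Safe G v → ∀ p q → H p q ≡ true → p ≢ q → ¬ NewEdge p q →
      deg H p ≤ deg H q → deg G p ≤ deg G q
    old-edge-order su sv p q h pq new le with position p | position q
    ... | inj₁ refl | inj₁ refl = ⊥-elim (pq refl)
    ... | inj₁ refl | inj₂ (inj₁ refl) = ⊥-elim (new (inj₁ (refl , refl)))
    ... | inj₁ refl | inj₂ (inj₂ (qu , qv)) = <⇒≤ (subst₂ _≤_ deg-u (deg-other q qu qv) le)
    ... | inj₂ (inj₁ refl) | inj₂ (inj₁ refl) = ⊥-elim (pq refl)
    ... | inj₂ (inj₁ refl) | inj₁ refl = ⊥-elim (new (inj₂ (refl , refl)))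
    ... | inj₂ (inj₁ refl) | inj₂ (inj₂ (qu , qv)) = <⇒≤ (subst₂ _≤_ deg-v (deg-other q qu qv) le)
    ... | inj₂ (inj₂ (pu , pv)) | inj₁ refl =
          s≤s⁻¹ (≤∧≢⇒< (subst₂ _≤_ (deg-other p pu pv) deg-u le) (su p (trans (proj₁ sG u p) (H⊆G p u h new))))
    ... | inj₂ (inj₂ (pu , pv)) | inj₂ (inj₁ refl) =
          s≤s⁻¹ (≤∧≢⇒< (subst₂ _≤_ (deg-other p pu pv) deg-v le) (sv p (trans (proj₁ sG v p) (H⊆G p v h new))))
    ... | inj₂ (inj₂ (pu , pv)) | inj₂ (inj₂ (qu , qv)) = subst₂ _≤_ (deg-other p pu pv) (deg-other q qu qv) le

    -- With u and v safe, a monotone path of H avoiding the edge uv would be one of G.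
    uses-new-edge : Safe G u → Safe G v → NoMonotone4 G → ∀ {a b c d} → Monotone4 H a b c d →
      NewEdge a b ⊎ NewEdge b c ⊎ NewEdge c d
    uses-new-edge su sv none {a} {b} {c} {d} path with newEdge? a b | newEdge? b c | newEdge? c d
    ... | yes e | _ | _ = inj₁ e
    ... | no _ | yes e | _ = inj₂ (inj₁ e)
    ... | no _ | no _ | yes e = inj₂ (inj₂ e)
    ... | no n1 | no n2 | no n3 = ⊥-elim (none a b c d old)
      where
      open Monotone4 path
      up : ∀ p q → H p q ≡ true → p ≢ q → ¬ NewEdge p q → deg H p ≤ deg H q → deg G p ≤ deg G q
      up = old-edge-order su sv
      down : ∀ p q → H p q ≡ true → p ≢ q → ¬ NewEdge p q → deg H q ≤ deg H p → deg G q ≤ deg G p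
      down p q h pq new le = up q p (trans (H-sym q p) h) (≢-sym pq) (λ e → new (newEdge-sym e)) le
      old : Monotone4 G a b c d
      old = mkMonotone4 dab dac dad dbc dbd dcd (H⊆G a b eab n1) (H⊆G b c ebc n2) (H⊆G c d ecd n3)
        ([ (λ { (x , y , z) → inj₁ (up a b eab dab n1 x , up b c ebc dbc n2 y , up c d ecd dcd n3 z) })
         , (λ { (x , y , z) → inj₂ (down a b eab dab n1 x , down b c ebc dbc n2 y , down c d ecd dcd n3 z) }) ]′ mono)

    new-path : Safe G u → Safe G v → NoMonotone4 G → HasMonotone4 H → NewPath H u v
    new-path su sv none (a , b , c , d , path) = shape (uses-new-edge su sv none path)
      where
      shape : NewEdge a b ⊎ NewEdge b c ⊎ NewEdge c d → NewPath H u v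
      shape (inj₁ (inj₁ (refl , refl))) = inj₁ (c , d , path)
      shape (inj₁ (inj₂ (refl , refl))) = inj₂ (inj₁ (c , d , path))
      shape (inj₂ (inj₁ (inj₁ (refl , refl)))) = inj₂ (inj₂ (inj₁ (a , d , path)))
      shape (inj₂ (inj₁ (inj₂ (refl , refl)))) = inj₂ (inj₂ (inj₂ (a , d , path)))
      shape (inj₂ (inj₂ (inj₁ (refl , refl)))) = inj₂ (inj₁ (b , a , reverse4 H-sym path))
      shape (inj₂ (inj₂ (inj₂ (refl , refl)))) = inj₁ (b , a , reverse4 H-sym path)

    avoids-uv : NoMonotone4 G → ∀ {a b c d} → Monotone4 H a b c d → Other a → Other b → Other c → Other d → ⊥
    avoids-uv none {a} {b} {c} {d} path oa ob oc od = none a b c d old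
      where
      open Monotone4 path
      old-edge : ∀ {x y} → Other x → H x y ≡ true → G x y ≡ true
      old-edge {x} {y} (xu , xv) = nbr-other x y xu xv
      same : ∀ {x y} → Other x → Other y → deg H x ≤ deg H y → deg G x ≤ deg G y
      same ox oy = subst₂ _≤_ (other-deg ox) (other-deg oy)
      old : Monotone4 G a b c d
      old = mkMonotone4 dab dac dad dbc dbd dcd (old-edge oa eab) (old-edge ob ebc) (old-edge oc ecd)
        ([ (λ { (x , y , z) → inj₁ (same oa ob x , same ob oc y , same oc od z) })
         , (λ { (x , y , z) → inj₂ (same ob oa x , same oc ob y , same od oc z) }) ]′ mono)

module Handshake where

  open Counting

  length-filter-++ : ∀ {A : Set} (p : A → Bool) (xs ys : List A) →
    length (filterᵇ p (xs ++ ys)) ≡ length (filterᵇ p xs) + length (filterᵇ p ys)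
  length-filter-++ p [] ys = refl
  length-filter-++ p (x ∷ xs) ys with p x
  ... | true = cong suc (length-filter-++ p xs ys)
  ... | false = length-filter-++ p xs ys

  length-filter-map : ∀ {A B : Set} (p : B → Bool) (h : A → B) (xs : List A) →
    length (filterᵇ p (map h xs)) ≡ length (filterᵇ (λ x → p (h x)) xs)
  length-filter-map p h [] = refl
  length-filter-map p h (x ∷ xs) with p (h x)
  ... | true = cong suc (length-filter-map p h xs)
  ... | false = length-filter-map p h xs

  length-filter-product : ∀ {A B : Set} {n} (g : Fin n → A) (ys : List B) (p : A × B → Bool) →
    length (filterᵇ p (cartesianProduct (tabulate g) ys)) ≡ ΣF (λ i → length (filterᵇ (λ y → p (g i , y)) ys))
  length-filter-product {n = zero} g ys p = refl
  length-filter-product {n = suc n} g ys p = trans (length-filter-++ p (map (g zero ,_) ys) _)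
    (cong₂ _+_ (length-filter-map p (g zero ,_) ys) (length-filter-product (λ i → g (suc i)) ys p))

  upper : ∀ {n} → Graph n → Fin n → Fin n → ℕ
  upper G i j = ind ((toℕ i <ᵇ toℕ j) ∧ G i j)

  edges≡ΣF : ∀ {n} (G : Graph n) → edges G ≡ ΣF (λ i → ΣF (λ j → upper G i j))
  edges≡ΣF {n} G =
    trans (length-filter-product (λ i → i) (allFin n) (λ p → (toℕ (proj₁ p) <ᵇ toℕ (proj₂ p)) ∧ G (proj₁ p) (proj₂ p)))
          (ΣF-ext (λ i → cnt≡ΣF (λ j → (toℕ i <ᵇ toℕ j) ∧ G i j)))

  adjacency-split : ∀ {n} (G : Graph n) → IsSimple G → ∀ i j → ind (G i j) ≡ upper G i j + upper G j i
  adjacency-split G (sy , ir) i j with toℕ i <ᵇ toℕ j in e1 | toℕ j <ᵇ toℕ i in e2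
  ... | true | true = ⊥-elim (<-asym (<ᵇ⇒< (toℕ i) (toℕ j) (subst T (sym e1) tt)) (<ᵇ⇒< (toℕ j) (toℕ i) (subst T (sym e2) tt)))
  ... | true | false = sym (+-identityʳ _)
  ... | false | true = cong ind (sy i j)
  ... | false | false = cong ind (trans (cong (λ k → G k j) i≡j) (ir j))
    where
    not< : ∀ {a b} → (a <ᵇ b) ≡ false → ¬ (a < b)
    not< e p = true≢false (trans (sym (T⇒≡ (<⇒<ᵇ p))) e)
    i≡j : i ≡ j
    i≡j = toℕ-injective (≤-antisym (≮⇒≥ (not< e2)) (≮⇒≥ (not< e1)))

  handshake : ∀ {n} (G : Graph n) → IsSimple G → ΣF (deg G) ≡ edges G + edges G
  handshake {n} G sG = begin
      ΣF (deg G)                                              ≡⟨ ΣF-ext (λ i → cnt≡ΣF (G i)) ⟩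
      ΣF (λ i → ΣF (λ j → ind (G i j)))                       ≡⟨ ΣF-ext (λ i → ΣF-ext (adjacency-split G sG i)) ⟩
      ΣF (λ i → ΣF (λ j → U i j + U j i))                     ≡⟨ ΣF-ext (λ i → ΣF-+ (U i) (λ j → U j i)) ⟩
      ΣF (λ i → ΣF (U i) + ΣF (λ j → U j i))                  ≡⟨ ΣF-+ (λ i → ΣF (U i)) (λ i → ΣF (λ j → U j i)) ⟩
      ΣF (λ i → ΣF (U i)) + ΣF (λ i → ΣF (λ j → U j i))       ≡⟨ cong (ΣF (λ i → ΣF (U i)) +_) (ΣF-swap (λ i j → U j i)) ⟩
      ΣF (λ i → ΣF (U i)) + ΣF (λ j → ΣF (λ i → U j i))       ≡⟨ cong₂ _+_ (sym (edges≡ΣF G)) (sym (edges≡ΣF G)) ⟩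
      edges G + edges G                                       ∎
    where
    open ≡-Reasoning
    U : Fin n → Fin n → ℕ
    U = upper G

module LocalCheck where

  open Counting using (true≢false; T⇒≡; ≡⇒T)
  open MonotonePaths

  ∧-l : ∀ {a b} → a ∧ b ≡ true → a ≡ true
  ∧-l {true} _ = refl

  ∧-r : ∀ {a b} → a ∧ b ≡ true → b ≡ true
  ∧-r {true} p = p

  ∧-i : ∀ {a b} → a ≡ true → b ≡ true → a ∧ b ≡ true
  ∧-i refl refl = refl

  ∨-l : ∀ {a b} → a ≡ true → a ∨ b ≡ true
  ∨-l refl = refl

  ∨-r : ∀ {a b} → b ≡ true → a ∨ b ≡ true
  ∨-r {true} _ = refl
  ∨-r {false} p = p

  ≢⇒not≟ : ∀ {k} {i j : Fin k} → i ≢ j → not ⌊ i ≟ j ⌋ ≡ true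
  ≢⇒not≟ {i = i} {j} ne with i ≟ j
  ... | yes p = ⊥-elim (ne p)
  ... | no _ = refl

  every : ∀ {k} → (Fin k → Bool) → Bool
  every {zero} f = true
  every {suc k} f = f zero ∧ every (λ i → f (suc i))

  every-sound : ∀ {k} {f : Fin k → Bool} → every f ≡ true → ∀ i → f i ≡ true
  every-sound {suc k} p zero = ∧-l p
  every-sound {suc k} {f} p (suc i) = every-sound {f = λ i → f (suc i)} (∧-r {f zero} p) i

  some : ∀ {k} → (Fin k → Bool) → Bool
  some {zero} f = false
  some {suc k} f = f zero ∨ some (λ i → f (suc i))

  some-sound : ∀ {k} (f : Fin k → Bool) → some f ≡ true → Σ (Fin k) λ i → f i ≡ true
  some-sound {suc k} f p with f zero in e
  ... | true = zero , e
  ... | false with some-sound (λ i → f (suc i)) p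
  ...   | i , q = suc i , q

  module SmallGraph {k : ℕ} (A : Fin k → Fin k → Bool) (D : Fin k → ℕ) where

    distinct4 : Fin k → Fin k → Fin k → Fin k → Bool
    distinct4 i j l m = not ⌊ i ≟ j ⌋ ∧ not ⌊ i ≟ l ⌋ ∧ not ⌊ i ≟ m ⌋ ∧ not ⌊ j ≟ l ⌋ ∧ not ⌊ j ≟ m ⌋ ∧ not ⌊ l ≟ m ⌋

    mono4 : Fin k → Fin k → Fin k → Fin k → Bool
    mono4 i j l m = ((D i ≤ᵇ D j) ∧ (D j ≤ᵇ D l) ∧ (D l ≤ᵇ D m)) ∨ ((D j ≤ᵇ D i) ∧ (D l ≤ᵇ D j) ∧ (D m ≤ᵇ D l))

    path4 : Fin k → Fin k → Fin k → Fin k → Bool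
    path4 i j l m = distinct4 i j l m ∧ A i j ∧ A j l ∧ A l m ∧ mono4 i j l m

    path4-sound : ∀ i j l m → path4 i j l m ≡ true →
      distinct4 i j l m ≡ true × A i j ≡ true × A j l ≡ true × A l m ≡ true × mono4 i j l m ≡ true
    path4-sound i j l m h with distinct4 i j l m | A i j | A j l | A l m | mono4 i j l m
    ... | true | true | true | true | true = refl , refl , refl , refl , refl

    distinct4-sound : ∀ {i j l m} → distinct4 i j l m ≡ true → i ≢ j × i ≢ l × i ≢ m × j ≢ l × j ≢ m × l ≢ m
    distinct4-sound {i} {j} {l} {m} h with i ≟ j | i ≟ l | i ≟ m | j ≟ l | j ≟ m | l ≟ m
    ... | no a | no b | no c | no d | no e | no f = a , b , c , d , e , f

    mono4-sound : ∀ {i j l m} → mono4 i j l m ≡ true →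
      ((D i ≤ᵇ D j) ≡ true × (D j ≤ᵇ D l) ≡ true × (D l ≤ᵇ D m) ≡ true) ⊎
      ((D j ≤ᵇ D i) ≡ true × (D l ≤ᵇ D j) ≡ true × (D m ≤ᵇ D l) ≡ true)
    mono4-sound {i} {j} {l} {m} h with D i ≤ᵇ D j | D j ≤ᵇ D l | D l ≤ᵇ D m | D j ≤ᵇ D i | D l ≤ᵇ D j | D m ≤ᵇ D l
    ... | true | true | true | _ | _ | _ = inj₁ (refl , refl , refl)
    ... | false | _ | _ | true | true | true = inj₂ (refl , refl , refl)
    ... | true | false | _ | true | true | true = inj₂ (refl , refl , refl)
    ... | true | true | false | true | true | true = inj₂ (refl , refl , refl)

    noPath4 : Bool
    noPath4 = every λ i → every λ j → every λ l → every λ m → not (path4 i j l m)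

    somePath4 : Bool
    somePath4 = some λ i → some λ j → some λ l → some λ m → path4 i j l m

    noPath4-sound : noPath4 ≡ true → ∀ i j l m → path4 i j l m ≡ true → ⊥
    noPath4-sound ok i j l m p = true≢false (trans (sym p) (not-true (every-sound (every-sound (every-sound (every-sound ok i) j) l) m)))
      where
      not-true : ∀ {b} → not b ≡ true → b ≡ false
      not-true {false} _ = refl

    somePath4-sound : somePath4 ≡ true → Σ (Fin k) λ i → Σ (Fin k) λ j → Σ (Fin k) λ l → Σ (Fin k) λ m → path4 i j l m ≡ true
    somePath4-sound p with some-sound _ p
    ... | i , p1 with some-sound _ p1
    ...   | j , p2 with some-sound _ p2
    ...     | l , p3 with some-sound _ p3
    ...       | m , p4 = i , j , l , m , p4

  module Labelled {n k : ℕ} (H : Graph n) (lab : Fin k → Fin n) (A : Fin k → Fin k → Bool) (D : Fin k → ℕ) where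

    open SmallGraph A D

    Image : Fin n → Set
    Image x = Σ (Fin k) λ i → lab i ≡ x

    module Down (hD : ∀ i → deg H (lab i) ≡ D i) (hA : ∀ i j → H (lab i) (lab j) ≡ true → A i j ≡ true) (ok : noPath4 ≡ true) where

      no-labelled-path : ∀ i j l m → ¬ Monotone4 H (lab i) (lab j) (lab l) (lab m)
      no-labelled-path i j l m (mkMonotone4 dab dac dad dbc dbd dcd eab ebc ecd mono) =
        noPath4-sound ok i j l m
          (∧-i (∧-i (ne dab) (∧-i (ne dac) (∧-i (ne dad) (∧-i (ne dbc) (∧-i (ne dbd) (ne dcd))))))
               (∧-i (hA i j eab) (∧-i (hA j l ebc) (∧-i (hA l m ecd) monoD))))
        where
        ne : ∀ {i j} → lab i ≢ lab j → not ⌊ i ≟ j ⌋ ≡ true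
        ne p = ≢⇒not≟ λ { refl → p refl }
        le : ∀ {i j} → deg H (lab i) ≤ deg H (lab j) → (D i ≤ᵇ D j) ≡ true
        le {i} {j} p = T⇒≡ (≤⇒≤ᵇ (subst₂ _≤_ (hD i) (hD j) p))
        monoD : mono4 i j l m ≡ true
        monoD = [ (λ { (x , y , z) → ∨-l (∧-i (le x) (∧-i (le y) (le z))) })
                , (λ { (x , y , z) → ∨-r (∧-i (le x) (∧-i (le y) (le z))) }) ]′ mono

      module Closed (sH : Sym H) (closed : ∀ i y → H (lab i) y ≡ true → Image y) where

        forward : ∀ {x y} → H x y ≡ true → Image x → Image y
        forward {x} {y} h (i , refl) = closed i y h

        backward : ∀ {x y} → H x y ≡ true → Image y → Image x
        backward {x} {y} h im = forward (trans (sH y x) h) im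

        untouched : ∀ {a b c d} → Monotone4 H a b c d → Image a ⊎ Image b ⊎ Image c ⊎ Image d → ⊥
        untouched {a} {b} {c} {d} path touch = inside (spread touch)
          where
          open Monotone4 path
          from-b : Image b → Image a × Image b × Image c × Image d
          from-b ib = backward eab ib , ib , forward ebc ib , forward ecd (forward ebc ib)
          spread : Image a ⊎ Image b ⊎ Image c ⊎ Image d → Image a × Image b × Image c × Image d
          spread (inj₁ ia) = from-b (forward eab ia)
          spread (inj₂ (inj₁ ib)) = from-b ib
          spread (inj₂ (inj₂ (inj₁ ic))) = from-b (backward ebc ic)
          spread (inj₂ (inj₂ (inj₂ id))) = from-b (backward ebc (backward ecd id))
          inside : Image a × Image b × Image c × Image d → ⊥
          inside ((i , refl) , (j , refl) , (l , refl) , (m , refl)) = no-labelled-path i j l m path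

  module Computed {k : ℕ} (A : Graph k) where
    open SmallGraph A (deg A)

    path4⇒Monotone4 : ∀ i j l m → path4 i j l m ≡ true → Monotone4 A i j l m
    path4⇒Monotone4 i j l m h with path4-sound i j l m h
    ... | dist , eij , ejl , elm , monoD with distinct4-sound dist
    ...   | d1 , d2 , d3 , d4 , d5 , d6 =
      mkMonotone4 d1 d2 d3 d4 d5 d6 eij ejl elm
                  ([ (λ { (x , y , z) → inj₁ (le x , le y , le z) }) , (λ { (x , y , z) → inj₂ (le x , le y , le z) }) ]′
                   (mono4-sound monoD))
      where
      le : ∀ {x y} → (deg A x ≤ᵇ deg A y) ≡ true → deg A x ≤ deg A y
      le {x} {y} p = ≤ᵇ⇒≤ (deg A x) (deg A y) (≡⇒T p)

    somePath4⇒HasMonotone4 : somePath4 ≡ true → HasMonotone4 A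
    somePath4⇒HasMonotone4 h = found (somePath4-sound h)
      where
      found : (Σ (Fin k) λ i → Σ (Fin k) λ j → Σ (Fin k) λ l → Σ (Fin k) λ m → path4 i j l m ≡ true) → HasMonotone4 A
      found (i , j , l , m , p) = i , j , l , m , path4⇒Monotone4 i j l m p

    noPath4⇒NoMonotone4 : noPath4 ≡ true → NoMonotone4 A
    noPath4⇒NoMonotone4 ok = Labelled.Down.no-labelled-path A (λ i → i) A (deg A) (λ _ → refl) (λ _ _ h → h) ok

module LowerBound where

  open Counting
  open MonotonePaths
  open AddEdge
  open NewPaths
  open Handshake
  open LocalCheck

  one-two-more : ∀ {k} → 1 ≤ k → k ≡ 1 ⊎ k ≡ 2 ⊎ 3 ≤ k
  one-two-more {1} _ = inj₁ refl
  one-two-more {2} _ = inj₂ (inj₁ refl)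
  one-two-more {suc (suc (suc k))} _ = inj₂ (inj₂ (s≤s (s≤s (s≤s z≤n))))

  -- Each lemma below adds a suitable edge uv and shows, by inspecting
  -- the shapes of NewPath (or by a finite check of a closed neighbourhood), that no
  -- monotone path arises, a contradiction.
  module Structure {n} (G : Graph n) (sG : IsSimple G) (none : NoMonotone4 G) (sat : Saturated4 G) where

    δ : Fin n → ℕ
    δ = deg G

    gs : ∀ {x y} → G x y ≡ true → G y x ≡ true
    gs {x} {y} h = trans (proj₁ sG y x) h

    irr : ∀ {x y} → G x y ≡ true → x ≢ y
    irr {x} h refl = true≢false (trans (sym h) (proj₂ sG x))

    non-adjacent : ∀ {x y} → ¬ (G x y ≡ true) → G x y ≡ false
    non-adjacent {x} {y} h with G x y
    ... | true = ⊥-elim (h refl)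
    ... | false = refl

    deg≥1 : ∀ {x y} → G x y ≡ true → 1 ≤ δ x
    deg≥1 {x} = cnt≥1 (G x)

    deg≥2 : ∀ {x y z} → G x y ≡ true → G x z ≡ true → y ≢ z → 2 ≤ δ x
    deg≥2 {x} = cnt≥2 (G x)

    leaf-nbr : ∀ {v w} → δ v ≡ 1 → G v w ≡ true → ∀ {y} → G v y ≡ true → y ≡ w
    leaf-nbr {v} dv = only1 (G v) (≤-reflexive dv)

    locally-max-safe : ∀ {m} → (∀ y → G m y ≡ true → δ y ≤ δ m) → Safe G m
    locally-max-safe le y g e = 1+n≰n (subst (_≤ δ _) e (le y g))

    leaf-safe : ∀ {v w} → δ v ≡ 1 → G v w ≡ true → δ w ≢ 2 → Safe G v
    leaf-safe dv gvw dw≢2 y g e with leaf-nbr dv gvw g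
    ... | refl = dw≢2 (trans e (cong suc dv))

    new-path-at : ∀ u v (u≢v : u ≢ v) (guv : G u v ≡ false) → Safe G u → Safe G v → NewPath (addEdge G u v) u v
    new-path-at u v u≢v guv su sv = ViaNewEdge.new-path G sG u v u≢v guv su sv none (sat u v u≢v guv)

    -- No vertex is isolated (when n ≥ 2): join it to a vertex m of maximum degree.
    module NoIsolated (v w : Fin n) (w≢v : w ≢ v) (dv : δ v ≡ 0) where
      isolated : ∀ y → ¬ (G v y ≡ true)
      isolated y h = <⇒≱ (deg≥1 h) (≤-reflexive dv)

      maxv : Σ (Fin n) λ m → m ∉ v ∷ [] × (∀ y → y ∉ v ∷ [] → δ y ≤ δ m)
      maxv = max-outside δ (v ∷ []) {w} λ { (here e) → w≢v e }
      m : Fin n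
      m = proj₁ maxv
      m≢v : m ≢ v
      m≢v e = proj₁ (proj₂ maxv) (here e)
      m-max : ∀ y → y ≢ v → δ y ≤ δ m
      m-max y y≢v = proj₂ (proj₂ maxv) y λ { (here e) → y≢v e }

      gvm : G v m ≡ false
      gvm = non-adjacent (isolated m)

      open Extend G sG v m (≢-sym m≢v) gvm

      -- In H, v has degree 1 and m degree δ m + 1, above every other degree.  The path
      -- v m c d would climb from m, or descend to v although m has the neighbour c; the
      -- other shapes need a neighbour of v besides m.
      refute : NewPath H v m → ⊥
      refute (inj₁ (c , d , mkMonotone4 _ dac _ dbc _ _ _ ebc _ mono)) = order mono
        where
        gmc : G m c ≡ true
        gmc = [ (λ g → g) , (λ e → ⊥-elim (dac (sym e))) ]′ (nbr-v c ebc)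
        order : Mono (deg H) v m c d → ⊥
        order (inj₁ (_ , mc , _)) =
          1+n≰n (≤-trans (subst₂ _≤_ deg-v (deg-other c (≢-sym dac) (≢-sym dbc)) mc) (m-max c (≢-sym dac)))
        order (inj₂ (mv , _ , _)) = <⇒≱ (s≤s (deg≥1 gmc)) (subst₂ _≤_ deg-v (trans deg-u (cong suc dv)) mv)
      refute (inj₂ (inj₁ (c , _ , mkMonotone4 _ dac _ _ _ _ _ ebc _ _))) =
        [ isolated c , (λ e → dac (sym e)) ]′ (nbr-u c ebc)
      refute (inj₂ (inj₂ (inj₁ (a , _ , mkMonotone4 _ dac _ _ _ _ eab _ _ _)))) =
        [ isolated a , dac ]′ (nbr-u a (trans (H-sym v a) eab))
      refute (inj₂ (inj₂ (inj₂ (_ , d , mkMonotone4 _ _ _ _ dbd _ _ _ ecd _)))) =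
        [ isolated d , (λ e → dbd (sym e)) ]′ (nbr-u d ecd)

      contradiction : ⊥
      contradiction = refute (new-path-at v m (≢-sym m≢v) gvm (λ y h → ⊥-elim (isolated y h))
                                          (locally-max-safe λ y g → m-max y λ { refl → isolated m (gs g) }))

    -- No component is a single edge vw (when n ≥ 3): join v to a vertex u of maximum
    -- degree outside {v, w}.
    module NoK2 (v w z : Fin n) (dv : δ v ≡ 1) (gvw : G v w ≡ true) (dw : δ w ≡ 1) (z≢v : z ≢ v) (z≢w : z ≢ w) where
      nbr-of-v : ∀ {y} → G v y ≡ true → y ≡ w
      nbr-of-v = leaf-nbr dv gvw
      nbr-of-w : ∀ {y} → G w y ≡ true → y ≡ v
      nbr-of-w = leaf-nbr dw (gs gvw)

      maxu : Σ (Fin n) λ u → u ∉ v ∷ w ∷ [] × (∀ y → y ∉ v ∷ w ∷ [] → δ y ≤ δ u)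
      maxu = max-outside δ (v ∷ w ∷ []) {z} λ { (here e) → z≢v e ; (there (here e)) → z≢w e }
      u : Fin n
      u = proj₁ maxu
      u≢v : u ≢ v
      u≢v e = proj₁ (proj₂ maxu) (here e)
      u≢w : u ≢ w
      u≢w e = proj₁ (proj₂ maxu) (there (here e))
      u-max : ∀ y → y ≢ v → y ≢ w → δ y ≤ δ u
      u-max y y≢v y≢w = proj₂ (proj₂ maxu) y λ { (here e) → y≢v e ; (there (here e)) → y≢w e }

      nbr-of-u : ∀ {y} → G u y ≡ true → y ≢ v × y ≢ w
      nbr-of-u g = (λ { refl → u≢w (nbr-of-v (gs g)) }) , (λ { refl → u≢v (nbr-of-w (gs g)) })

      u-bounds : ∀ {y} → G u y ≡ true → δ y ≤ δ u
      u-bounds {y} g = u-max y (proj₁ (nbr-of-u g)) (proj₂ (nbr-of-u g))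

      gvu : G v u ≡ false
      gvu = non-adjacent (λ g → u≢w (nbr-of-v g))

      open Extend G sG v u (≢-sym u≢v) gvu

      degH-v : deg H v ≡ 2
      degH-v = trans deg-u (cong suc dv)

      -- In H, v has degree 2, w keeps degree 1, and u has degree δ u + 1, above the degree
      -- of each of its G-neighbours; in each of the four shapes this contradicts monotonicity.
      refute : NewPath H v u → ⊥
      refute (inj₁ (c , d , mkMonotone4 _ dac _ dbc dbd _ _ ebc ecd mono)) = order mono
        where
        guc : G u c ≡ true
        guc = [ (λ g → g) , (λ e → ⊥-elim (dac (sym e))) ]′ (nbr-v c ebc)
        degH-c : deg H c ≡ δ c
        degH-c = deg-other c (≢-sym dac) (≢-sym dbc)
        order : Mono (deg H) v u c d → ⊥
        order (inj₁ (_ , uc , _)) = 1+n≰n (≤-trans (subst₂ _≤_ deg-v degH-c uc) (u-bounds guc))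
        order (inj₂ (uv , _ , _)) =
          1+n≰n (≤-trans (deg≥2 (gs guc) (nbr-other c d (≢-sym dac) (≢-sym dbc) ecd) dbd)
                         (≤-trans (u-bounds guc) (s≤s⁻¹ (subst₂ _≤_ deg-v degH-v uv))))
      refute (inj₂ (inj₁ (c , d , mkMonotone4 _ dac _ dbc dbd _ _ ebc ecd _))) = dbd (sym (nbr-of-w gwd))
        where
        c≡w : c ≡ w
        c≡w = [ nbr-of-v , (λ e → ⊥-elim (dac (sym e))) ]′ (nbr-u c ebc)
        gwd : G w d ≡ true
        gwd = subst (λ t → G t d ≡ true) c≡w (nbr-other c d (≢-sym dbc) (≢-sym dac) ecd)
      refute (inj₂ (inj₂ (inj₁ (a , d , mkMonotone4 dab dac _ _ dbd dcd eab _ ecd mono)))) = order mono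
        where
        a≡w : a ≡ w
        a≡w = [ nbr-of-v , (λ e → ⊥-elim (dac e)) ]′ (nbr-u a (trans (H-sym v a) eab))
        gud : G u d ≡ true
        gud = [ (λ g → g) , (λ e → ⊥-elim (dbd (sym e))) ]′ (nbr-v d ecd)
        order : Mono (deg H) a v u d → ⊥
        order (inj₁ (_ , _ , ud)) = 1+n≰n (≤-trans (subst₂ _≤_ deg-v (deg-other d (≢-sym dbd) (≢-sym dcd)) ud) (u-bounds gud))
        order (inj₂ (va , _ , _)) = 1+n≰n (subst₂ _≤_ degH-v (trans (deg-other a dab dac) (trans (cong δ a≡w) dw)) va)
      refute (inj₂ (inj₂ (inj₂ (a , d , mkMonotone4 dab dac _ _ dbd dcd eab _ ecd mono)))) = order mono
        where
        d≡w : d ≡ w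
        d≡w = [ nbr-of-v , (λ e → ⊥-elim (dbd (sym e))) ]′ (nbr-u d ecd)
        gua : G u a ≡ true
        gua = [ (λ g → g) , (λ e → ⊥-elim (dac e)) ]′ (nbr-v a (trans (H-sym u a) eab))
        order : Mono (deg H) a u v d → ⊥
        order (inj₁ (_ , _ , vd)) =
          1+n≰n (subst₂ _≤_ degH-v (trans (deg-other d (λ e → dcd (sym e)) (λ e → dbd (sym e))) (trans (cong δ d≡w) dw)) vd)
        order (inj₂ (ua , _ , _)) = 1+n≰n (≤-trans (subst₂ _≤_ deg-v (deg-other a dac dab) ua) (u-bounds gua))

      contradiction : ⊥
      contradiction = refute (new-path-at v u (≢-sym u≢v) gvu (leaf-safe dv gvw λ e → 1≢2 (trans (sym dw) e))
                                          (locally-max-safe λ y g → u-bounds g))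
        where 1≢2 : 1 ≢ 2
              1≢2 ()

    -- A leaf v whose neighbour w has degree ≥ 3 is adjacent to every vertex m of maximum
    -- degree: otherwise join v to m.
    module LeafSeesMax (v w m : Fin n) (dv : δ v ≡ 1) (gvw : G v w ≡ true) (dw≥3 : 3 ≤ δ w)
      (m-max : ∀ z → δ z ≤ δ m) (m≢w : m ≢ w) where
      nbr-of-v : ∀ {y} → G v y ≡ true → y ≡ w
      nbr-of-v = leaf-nbr dv gvw

      dm≥3 : 3 ≤ δ m
      dm≥3 = ≤-trans dw≥3 (m-max w)

      v≢m : v ≢ m
      v≢m refl = <⇒≱ dm≥3 (subst (_≤ 2) (sym dv) (s≤s z≤n))

      gvm : G v m ≡ false
      gvm = non-adjacent (λ g → m≢w (nbr-of-v g))

      open Extend G sG v m v≢m gvm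

      degH-v : deg H v ≡ 2
      degH-v = trans deg-u (cong suc dv)

      m-above-v : ¬ (deg H m ≤ deg H v)
      m-above-v le = <⇒≱ dm≥3 (≤-trans (s≤s⁻¹ (subst₂ _≤_ deg-v degH-v le)) (n≤1+n 1))

      w-above-v : ∀ {x} → x ≡ w → ¬ (deg H x ≤ deg H v)
      w-above-v refl le = <⇒≱ dw≥3 (subst₂ _≤_ (deg-other w (λ e → irr gvw (sym e)) (≢-sym m≢w)) degH-v le)

      -- In H, v has degree 2 < 3 ≤ δ w, and m has the largest degree δ m + 1 ≥ 4; every
      -- shape has to climb from m or to descend from m or w to v.
      refute : NewPath H v m → ⊥
      refute (inj₁ (c , d , mkMonotone4 _ dac _ dbc _ _ _ _ _ mono)) = order mono
        where
        order : Mono (deg H) v m c d → ⊥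
        order (inj₁ (_ , mc , _)) =
          1+n≰n (≤-trans (subst₂ _≤_ deg-v (deg-other c (≢-sym dac) (≢-sym dbc)) mc) (m-max c))
        order (inj₂ (mv , _ , _)) = m-above-v mv
      refute (inj₂ (inj₁ (c , d , mkMonotone4 _ dac _ _ _ _ _ ebc _ mono))) = order mono
        where
        c≡w : c ≡ w
        c≡w = [ nbr-of-v , (λ e → ⊥-elim (dac (sym e))) ]′ (nbr-u c ebc)
        order : Mono (deg H) m v c d → ⊥
        order (inj₁ (mv , _ , _)) = m-above-v mv
        order (inj₂ (_ , cv , _)) = w-above-v c≡w cv
      refute (inj₂ (inj₂ (inj₁ (a , d , mkMonotone4 _ dac _ _ _ _ eab _ _ mono)))) = order mono
        where
        a≡w : a ≡ w
        a≡w = [ nbr-of-v , (λ e → ⊥-elim (dac e)) ]′ (nbr-u a (trans (H-sym v a) eab))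
        order : Mono (deg H) a v m d → ⊥
        order (inj₁ (av , _ , _)) = w-above-v a≡w av
        order (inj₂ (_ , mv , _)) = m-above-v mv
      refute (inj₂ (inj₂ (inj₂ (a , d , mkMonotone4 dab dac _ _ _ _ _ _ _ mono)))) = order mono
        where
        order : Mono (deg H) a m v d → ⊥
        order (inj₁ (_ , mv , _)) = m-above-v mv
        order (inj₂ (ma , _ , _)) = 1+n≰n (≤-trans (subst₂ _≤_ deg-v (deg-other a dac dab) ma) (m-max a))

      contradiction : ⊥
      contradiction = refute (new-path-at v m v≢m gvm (leaf-safe dv gvw λ e → <⇒≱ dw≥3 (≤-reflexive e))
                                          (locally-max-safe λ y _ → m-max y))

    -- Two leaves v, v' cannot hang on the same vertex w of strictly maximum degree ≥ 3:
    -- join v to v'.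
    module TwoLeaves (v v' w : Fin n) (v≢v' : v ≢ v') (dv : δ v ≡ 1) (dv' : δ v' ≡ 1)
      (gvw : G v w ≡ true) (gv'w : G v' w ≡ true) (dw≥3 : 3 ≤ δ w) (w-max : ∀ z → z ≢ w → δ z < δ w) where
      nbr-of-v : ∀ {y} → G v y ≡ true → y ≡ w
      nbr-of-v = leaf-nbr dv gvw
      nbr-of-v' : ∀ {y} → G v' y ≡ true → y ≡ w
      nbr-of-v' = leaf-nbr dv' gv'w

      gvv' : G v v' ≡ false
      gvv' = non-adjacent (λ g → irr gv'w (nbr-of-v g))

      open Extend G sG v v' v≢v' gvv'

      degH-w : deg H w ≡ δ w
      degH-w = deg-other w (λ e → irr gvw (sym e)) (λ e → irr gv'w (sym e))

      leaf-below-w : ∀ {x} → deg H x ≡ 2 → ¬ (deg H w ≤ deg H x)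
      leaf-below-w e le = <⇒≱ dw≥3 (subst₂ _≤_ degH-w e le)

      w-top : ∀ {d} → d ≢ v → d ≢ v' → d ≢ w → ¬ (deg H w ≤ deg H d)
      w-top {d} d≢v d≢v' d≢w le = <⇒≱ (subst (_< δ w) (sym (deg-other d d≢v d≢v')) (w-max d d≢w)) (subst (_≤ deg H d) degH-w le)

      -- In H both leaves have degree 2, and w, their only other neighbour, keeps the
      -- strictly largest degree δ w ≥ 3.  A path using vv' cannot reach w on both sides,
      -- and at w it can neither climb further nor turn down to a leaf.
      refute : NewPath H v v' → ⊥
      refute (inj₁ (c , d , mkMonotone4 _ dac dad _ dbd dcd _ ebc _ mono)) with
        [ nbr-of-v' , (λ e → ⊥-elim (dac (sym e))) ]′ (nbr-v c ebc)
      ... | refl = [ (λ { (_ , _ , wd) → w-top (≢-sym dad) (≢-sym dbd) (≢-sym dcd) wd })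
                   , (λ { (_ , wv' , _) → leaf-below-w (trans deg-v (cong suc dv')) wv' }) ]′ mono
      refute (inj₂ (inj₁ (c , d , mkMonotone4 _ dac dad _ dbd dcd _ ebc _ mono))) with
        [ nbr-of-v , (λ e → ⊥-elim (dac (sym e))) ]′ (nbr-u c ebc)
      ... | refl = [ (λ { (_ , _ , wd) → w-top (≢-sym dbd) (≢-sym dad) (≢-sym dcd) wd })
                   , (λ { (_ , wv , _) → leaf-below-w (trans deg-u (cong suc dv)) wv }) ]′ mono
      refute (inj₂ (inj₂ (inj₁ (a , d , mkMonotone4 _ dac dad _ dbd _ eab _ ecd _)))) =
        dad (trans ([ nbr-of-v , (λ e → ⊥-elim (dac e)) ]′ (nbr-u a (trans (H-sym v a) eab)))
                   (sym ([ nbr-of-v' , (λ e → ⊥-elim (dbd (sym e))) ]′ (nbr-v d ecd))))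
      refute (inj₂ (inj₂ (inj₂ (a , d , mkMonotone4 _ dac dad _ dbd _ eab _ ecd _)))) =
        dad (trans ([ nbr-of-v' , (λ e → ⊥-elim (dac e)) ]′ (nbr-v a (trans (H-sym v' a) eab)))
                   (sym ([ nbr-of-v , (λ e → ⊥-elim (dbd (sym e))) ]′ (nbr-u d ecd))))

      contradiction : ⊥
      contradiction = refute (new-path-at v v' v≢v' gvv' (leaf-safe dv gvw λ e → <⇒≱ dw≥3 (≤-reflexive e))
                                                         (leaf-safe dv' gv'w λ e → <⇒≱ dw≥3 (≤-reflexive e)))

    -- Adding uv inside a small configuration that can be checked by computation: if the
    -- vertices labelled by lab include u and v and are closed under H-neighbours, if the
    -- table A contains the H-edges between them, D gives their H-degrees and (A, D) has no
    -- monotone path, then H = G + uv has no monotone path at all.  (A path meeting the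
    -- labelled vertices lies among them; a path avoiding u and v is one of G.)
    module Locally (u v : Fin n) (u≢v : u ≢ v) (guv : G u v ≡ false) {k : ℕ}
      (lab : Fin k → Fin n) (A : Fin k → Fin k → Bool) (D : Fin k → ℕ) where
      open Extend G sG u v u≢v guv
      open ViaNewEdge G sG u v u≢v guv using (Other; avoids-uv)
      open Labelled H lab A D using (Image; module Down)

      refute : (∀ i j → H (lab i) (lab j) ≡ true → A i j ≡ true) → (∀ i → deg H (lab i) ≡ D i) →
        SmallGraph.noPath4 A D ≡ true → (∀ i y → H (lab i) y ≡ true → Image y) → Image u → Image v → ⊥
      refute hA hD ok closed iu iv = check (sat u v u≢v guv)
        where
        open Down hD hA ok
        open Closed H-sym closed
        image-or-other : ∀ x → Image x ⊎ Other x
        image-or-other x with position x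
        ... | inj₁ refl = inj₁ iu
        ... | inj₂ (inj₁ refl) = inj₁ iv
        ... | inj₂ (inj₂ o) = inj₂ o
        check : HasMonotone4 H → ⊥
        check (a , b , c , d , path) with image-or-other a | image-or-other b | image-or-other c | image-or-other d
        ... | inj₁ i | _ | _ | _ = untouched path (inj₁ i)
        ... | inj₂ _ | inj₁ i | _ | _ = untouched path (inj₂ (inj₁ i))
        ... | inj₂ _ | inj₂ _ | inj₁ i | _ = untouched path (inj₂ (inj₂ (inj₁ i)))
        ... | inj₂ _ | inj₂ _ | inj₂ _ | inj₁ i = untouched path (inj₂ (inj₂ (inj₂ i)))
        ... | inj₂ oa | inj₂ ob | inj₂ oc | inj₂ od = avoids-uv none path oa ob oc od

    -- A leaf v is not attached to a vertex w of degree 2.  Let x be the other neighbour of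
    -- w and add the edge vx; the argument depends on the degree of x.
    module LeafOnDeg2 (v w x : Fin n) (dv : δ v ≡ 1) (gvw : G v w ≡ true) (dw : δ w ≡ 2) (gwx : G w x ≡ true) (x≢v : x ≢ v) where
      nbr-of-v : ∀ {y} → G v y ≡ true → y ≡ w
      nbr-of-v = leaf-nbr dv gvw
      nbr-of-w : ∀ {y} → G w y ≡ true → y ≡ v ⊎ y ≡ x
      nbr-of-w = only2 (G w) (≤-reflexive dw) (gs gvw) gwx (≢-sym x≢v)
      w≢v : w ≢ v
      w≢v e = irr gvw (sym e)
      w≢x : w ≢ x
      w≢x = irr gwx
      gvx : G v x ≡ false
      gvx = non-adjacent (λ g → w≢x (sym (nbr-of-v g)))
      nbr-of-x : ∀ {y} → G x y ≡ true → y ≢ v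
      nbr-of-x g refl = w≢x (sym (nbr-of-v (gs g)))

      open Extend G sG v x (≢-sym x≢v) gvx

      degH-v : deg H v ≡ 2
      degH-v = trans deg-u (cong suc dv)
      degH-w : deg H w ≡ 2
      degH-w = trans (deg-other w w≢v w≢x) dw
      H-nbr-of-v : ∀ {z} → H v z ≡ true → z ≡ w ⊎ z ≡ x
      H-nbr-of-v {z} h = [ (λ g → inj₁ (nbr-of-v g)) , inj₂ ]′ (nbr-u z h)
      H-nbr-of-w : ∀ {z} → H w z ≡ true → z ≡ v ⊎ z ≡ x
      H-nbr-of-w {z} h = nbr-of-w (nbr-other w z w≢v w≢x h)

      -- δ x = 1: the component is the path v w x, and H on it is a triangle of degree-2 vertices.
      path3 : δ x ≡ 1 → ⊥
      path3 dx = Locally.refute v x (≢-sym x≢v) gvx lab (λ _ _ → true) (λ _ → 2)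
                   (λ _ _ _ → refl) degrees refl closed (# 0 , refl) (# 2 , refl)
        where
        lab : Fin 3 → Fin n
        lab zero = v
        lab (suc zero) = w
        lab (suc (suc zero)) = x
        degrees : ∀ i → deg H (lab i) ≡ 2
        degrees zero = degH-v
        degrees (suc zero) = degH-w
        degrees (suc (suc zero)) = trans deg-v (cong suc dx)
        closed : ∀ i y → H (lab i) y ≡ true → Σ (Fin 3) λ j → lab j ≡ y
        closed zero y h = [ (λ e → # 1 , sym e) , (λ e → # 2 , sym e) ]′ (H-nbr-of-v h)
        closed (suc zero) y h = [ (λ e → # 0 , sym e) , (λ e → # 2 , sym e) ]′ (H-nbr-of-w h)
        closed (suc (suc zero)) y h =
          [ (λ g → # 1 , sym (only1 (G x) (≤-reflexive dx) (gs gwx) g)) , (λ e → # 0 , sym e) ]′ (nbr-v y h)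

      -- δ x = 2: the other neighbour y of x is a leaf (else v w x y is monotone), so the
      -- component is the path v w x y, and H on it has no monotone path.
      module Path4 (dx : δ x ≡ 2) (y : Fin n) (gxy : G x y ≡ true) (y≢w : y ≢ w) where
        y≢v : y ≢ v
        y≢v = nbr-of-x gxy
        x≢y : x ≢ y
        x≢y = irr gxy
        dy : δ y ≡ 1
        dy with 2 ≤? δ y
        ... | yes le = ⊥-elim (none v w x y (mkMonotone4 (≢-sym w≢v) (≢-sym x≢v) (≢-sym y≢v) w≢x (≢-sym y≢w) x≢y gvw gwx gxy
                  (inj₁ (subst₂ _≤_ (sym dv) (sym dw) (s≤s z≤n) , subst₂ _≤_ (sym dw) (sym dx) ≤-refl , subst (_≤ δ y) (sym dx) le))))
        ... | no nle = ≤-antisym (s≤s⁻¹ (≰⇒> nle)) (deg≥1 (gs gxy))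

        -- H on v, w, x, y: the triangle v w x with the pendant edge xy.
        A : Fin 4 → Fin 4 → Bool
        A zero (suc (suc (suc zero))) = false
        A (suc (suc (suc zero))) zero = false
        A (suc zero) (suc (suc (suc zero))) = false
        A (suc (suc (suc zero))) (suc zero) = false
        A _ _ = true
        D : Fin 4 → ℕ
        D zero = 2
        D (suc zero) = 2
        D (suc (suc zero)) = 3
        D (suc (suc (suc zero))) = 1
        lab : Fin 4 → Fin n
        lab zero = v
        lab (suc zero) = w
        lab (suc (suc zero)) = x
        lab (suc (suc (suc zero))) = y

        not-vy : ¬ (H v y ≡ true)
        not-vy h = [ y≢w , (λ e → x≢y (sym e)) ]′ (H-nbr-of-v h)
        not-wy : ¬ (H w y ≡ true)
        not-wy h = [ y≢v , (λ e → x≢y (sym e)) ]′ (H-nbr-of-w h)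
        edges-in-A : ∀ i j → H (lab i) (lab j) ≡ true → A i j ≡ true
        edges-in-A zero (suc (suc (suc zero))) h = ⊥-elim (not-vy h)
        edges-in-A (suc (suc (suc zero))) zero h = ⊥-elim (not-vy (trans (H-sym v y) h))
        edges-in-A (suc zero) (suc (suc (suc zero))) h = ⊥-elim (not-wy h)
        edges-in-A (suc (suc (suc zero))) (suc zero) h = ⊥-elim (not-wy (trans (H-sym w y) h))
        edges-in-A zero zero _ = refl
        edges-in-A zero (suc zero) _ = refl
        edges-in-A zero (suc (suc zero)) _ = refl
        edges-in-A (suc zero) zero _ = refl
        edges-in-A (suc zero) (suc zero) _ = refl
        edges-in-A (suc zero) (suc (suc zero)) _ = refl
        edges-in-A (suc (suc zero)) _ _ = refl
        edges-in-A (suc (suc (suc zero))) (suc (suc zero)) _ = refl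
        edges-in-A (suc (suc (suc zero))) (suc (suc (suc zero))) _ = refl
        degrees : ∀ i → deg H (lab i) ≡ D i
        degrees zero = degH-v
        degrees (suc zero) = degH-w
        degrees (suc (suc zero)) = trans deg-v (cong suc dx)
        degrees (suc (suc (suc zero))) = trans (deg-other y y≢v (≢-sym x≢y)) dy
        closed : ∀ i z → H (lab i) z ≡ true → Σ (Fin 4) λ j → lab j ≡ z
        closed zero z h = [ (λ e → # 1 , sym e) , (λ e → # 2 , sym e) ]′ (H-nbr-of-v h)
        closed (suc zero) z h = [ (λ e → # 0 , sym e) , (λ e → # 2 , sym e) ]′ (H-nbr-of-w h)
        closed (suc (suc zero)) z h =
          [ (λ g → [ (λ e → # 1 , sym e) , (λ e → # 3 , sym e) ]′ (only2 (G x) (≤-reflexive dx) (gs gwx) gxy (≢-sym y≢w) g))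
          , (λ e → # 0 , sym e) ]′ (nbr-v z h)
        closed (suc (suc (suc zero))) z h = # 2 , sym (only1 (G y) (≤-reflexive dy) (gs gxy) (nbr-other y z y≢v (≢-sym x≢y) h))

        contradiction : ⊥
        contradiction = Locally.refute v x (≢-sym x≢v) gvx lab A D edges-in-A degrees refl closed (# 0 , refl) (# 2 , refl)

      -- Any walk b c d of H with b ∈ {v, w} and b ≠ d must pass through x: in H the vertices
      -- v and w are adjacent only to each other and to x.
      trapped : ∀ {b c d} → H b c ≡ true → H c d ≡ true → b ≡ v ⊎ b ≡ w → b ≢ d → c ≢ x → d ≢ x → ⊥
      trapped hbc hcd (inj₁ refl) b≢d c≢x d≢x with H-nbr-of-v hbc
      ... | inj₂ c≡x = c≢x c≡x
      ... | inj₁ refl = [ b≢d ∘ sym , d≢x ]′ (H-nbr-of-w hcd)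
      trapped hbc hcd (inj₂ refl) b≢d c≢x d≢x with H-nbr-of-w hbc
      ... | inj₂ c≡x = c≢x c≡x
      ... | inj₁ refl = [ b≢d ∘ sym , d≢x ]′ (H-nbr-of-v hcd)

      -- δ x ≥ 3: every neighbour z ≠ w of x has smaller degree (else v w x z is monotone),
      -- so in H the vertex x is a strict local maximum.  A monotone path of H therefore
      -- cannot pass through x, cannot start at x, and cannot avoid x either.
      module Hub (dx≥3 : 3 ≤ δ x) where
        lower-nbr : ∀ z → G x z ≡ true → z ≢ w → δ z < δ x
        lower-nbr z g z≢w with δ x ≤? δ z
        ... | no nle = ≰⇒> nle
        ... | yes le = ⊥-elim (none v w x z (mkMonotone4 (≢-sym w≢v) (≢-sym x≢v) (≢-sym (nbr-of-x g)) w≢x (≢-sym z≢w) (irr g) gvw gwx g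
                  (inj₁ (subst₂ _≤_ (sym dv) (sym dw) (s≤s z≤n) , subst (_≤ δ x) (sym dw) (≤-trans (n≤1+n 2) dx≥3) , le))))

        x-strict-max : ∀ z → H x z ≡ true → deg H z < deg H x
        x-strict-max z h with nbr-v z h
        ... | inj₂ refl = subst₂ _<_ (sym degH-v) (sym deg-v) (s≤s (≤-trans (n≤1+n 2) dx≥3))
        ... | inj₁ g with z ≟ w
        ...   | yes refl = subst₂ _<_ (sym degH-w) (sym deg-v) (s≤s (≤-trans (n≤1+n 2) dx≥3))
        ...   | no z≢w = subst₂ _<_ (sym (deg-other z (nbr-of-x g) (≢-sym (irr g)))) (sym deg-v)
                                   (≤-trans (lower-nbr z g z≢w) (n≤1+n _))

        -- A monotone path starting at x descends; it cannot turn into {v, w}, and otherwise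
        -- it is a descending path of G.
        not-from-x : ∀ {b c d} → Monotone4 H x b c d → ⊥
        not-from-x {b} {c} {d} (mkMonotone4 dab dac dad dbc dbd dcd eab ebc ecd mono) = order mono
          where
          order : Mono (deg H) x b c d → ⊥
          order (inj₁ (xb , _ , _)) = <⇒≱ (x-strict-max b eab) xb
          order (inj₂ (_ , cb , dc)) with nbr-v b eab
          ... | inj₂ b≡v = trapped ebc ecd (inj₁ b≡v) dbd (≢-sym dac) (≢-sym dad)
          ... | inj₁ gxb with b ≟ w
          ...   | yes b≡w = trapped ebc ecd (inj₂ b≡w) dbd (≢-sym dac) (≢-sym dad)
          ...   | no b≢w = none x b c d (mkMonotone4 dab dac dad dbc dbd dcd gxb (nbr-other b c b≢v b≢x ebc) (nbr-other c d c≢v c≢x ecd)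
                    (inj₂ (<⇒≤ (lower-nbr b gxb b≢w) , subst₂ _≤_ (deg-other c c≢v c≢x) (deg-other b b≢v b≢x) cb
                                                      , subst₂ _≤_ (deg-other d d≢v d≢x) (deg-other c c≢v c≢x) dc)))
            where
            b≢v : b ≢ v
            b≢v = nbr-of-x gxb
            b≢x : b ≢ x
            b≢x = ≢-sym dab
            c≢x : c ≢ x
            c≢x = ≢-sym dac
            c≢v : c ≢ v
            c≢v refl = [ b≢w , b≢x ]′ (H-nbr-of-v (trans (H-sym v b) ebc))
            c≢w : c ≢ w
            c≢w refl = [ b≢v , b≢x ]′ (H-nbr-of-w (trans (H-sym w b) ebc))
            d≢x : d ≢ x
            d≢x = ≢-sym dad
            d≢v : d ≢ v
            d≢v refl = [ c≢w , c≢x ]′ (H-nbr-of-v (trans (H-sym v c) ecd))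

        not-above : ∀ {z} → H x z ≡ true → ¬ (deg H x ≤ deg H z)
        not-above {z} h = <⇒≱ (x-strict-max z h)

        contradiction : ⊥
        contradiction with sat v x (≢-sym x≢v) gvx
        ... | a , b , c , d , path with a ≟ x | b ≟ x | c ≟ x | d ≟ x
        ... | yes refl | _ | _ | _ = not-from-x path
        ... | no _ | _ | _ | yes refl = not-from-x (reverse4 H-sym path)
        ... | no _ | yes refl | _ | no _ = [ (λ { (_ , xc , _) → not-above ebc xc })
                                            , (λ { (xa , _ , _) → not-above (trans (H-sym x a) eab) xa }) ]′ mono
          where open Monotone4 path
        ... | no _ | no _ | yes refl | no _ = [ (λ { (_ , _ , xd) → not-above ecd xd })
                                                , (λ { (_ , xb , _) → not-above (trans (H-sym x b) ebc) xb }) ]′ mono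
          where open Monotone4 path
        ... | no a≢x | no b≢x | no c≢x | no d≢x with a ≟ v | b ≟ v | c ≟ v | d ≟ v
        ...   | yes a≡v | _ | _ | _ = trapped eab ebc (inj₁ a≡v) dac b≢x c≢x
          where open Monotone4 path
        ...   | _ | yes b≡v | _ | _ = trapped ebc ecd (inj₁ b≡v) dbd c≢x d≢x
          where open Monotone4 path
        ...   | _ | _ | yes c≡v | _ = trapped (trans (H-sym c b) ebc) (trans (H-sym b a) eab) (inj₁ c≡v) (≢-sym dac) b≢x a≢x
          where open Monotone4 path
        ...   | _ | _ | _ | yes d≡v = trapped (trans (H-sym d c) ecd) (trans (H-sym c b) ebc) (inj₁ d≡v) (≢-sym dbd) c≢x b≢x
          where open Monotone4 path
        ...   | no a≢v | no b≢v | no c≢v | no d≢v =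
          ViaNewEdge.avoids-uv G sG v x (≢-sym x≢v) gvx none path (a≢v , a≢x) (b≢v , b≢x) (c≢v , c≢x) (d≢v , d≢x)

      contradiction : ⊥
      contradiction with one-two-more (deg≥1 (gs gwx))
      ... | inj₁ dx = path3 dx
      ... | inj₂ (inj₂ dx≥3) = Hub.contradiction dx≥3
      ... | inj₂ (inj₁ dx) with another (G x) w (≤-reflexive (sym dx))
      ...   | y , gxy , y≢w = Path4.contradiction dx y gxy y≢w

    leaf-not-on-deg2 : ∀ v w → δ v ≡ 1 → G v w ≡ true → δ w ≢ 2
    leaf-not-on-deg2 v w dv gvw dw with another (G w) v (≤-reflexive (sym dw))
    ... | x , gwx , x≢v = LeafOnDeg2.contradiction v w x dv gvw dw gwx x≢v

    -- The paw: a leaf v on a vertex w of degree 3 whose other neighbours x, y, like all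
    -- remaining vertices, have degree 2.  Then x and y are adjacent (otherwise a path
    -- x'' x' x w of degrees 2, 2, 2, 3 arises), so {v, w, x, y} is a component, and adding
    -- vx inside it creates no monotone path.
    module Paw (v w x y : Fin n) (dv : δ v ≡ 1) (gvw : G v w ≡ true) (dw : δ w ≡ 3)
      (gwx : G w x ≡ true) (gwy : G w y ≡ true) (x≢v : x ≢ v) (y≢v : y ≢ v) (y≢x : y ≢ x)
      (others : ∀ z → z ≢ v → z ≢ w → δ z ≡ 2) where
      nbr-of-v : ∀ {z} → G v z ≡ true → z ≡ w
      nbr-of-v = leaf-nbr dv gvw
      nbr-of-w : ∀ {z} → G w z ≡ true → z ≡ v ⊎ z ≡ x ⊎ z ≡ y
      nbr-of-w = only3 (G w) (≤-reflexive dw) (gs gvw) gwx gwy (≢-sym x≢v) (≢-sym y≢v) (≢-sym y≢x)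
      x≢w : x ≢ w
      x≢w e = irr gwx (sym e)
      y≢w : y ≢ w
      y≢w e = irr gwy (sym e)
      dx : δ x ≡ 2
      dx = others x x≢v x≢w
      dy : δ y ≡ 2
      dy = others y y≢v y≢w

      not-v : ∀ {a z} → G a z ≡ true → a ≢ w → z ≢ v
      not-v g a≢w refl = a≢w (nbr-of-v (gs g))

      -- A neighbour x' ∉ {w, y} of x would have a further neighbour x'', and x'' x' x w
      -- would be a monotone path of degrees 2, 2, 2, 3.
      no-detour : ∀ {x'} → G x x' ≡ true → x' ≢ w → x' ≢ y → ⊥
      no-detour {x'} gxx' x'≢w x'≢y with another (G x') x (≤-reflexive (sym (others x' (not-v gxx' x≢w) x'≢w)))
      ... | x'' , gx'x'' , x''≢x = none x'' x' x w (mkMonotone4 (≢-sym (irr gx'x'')) x''≢x x''≢w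
              (≢-sym (irr gxx')) x'≢w x≢w (gs gx'x'') (gs gxx') (gs gwx)
              (inj₁ (≤-reflexive (trans (others x'' (not-v gx'x'' x'≢w) x''≢w) (sym dx'))
                    , ≤-reflexive (trans dx' (sym dx)) , subst₂ _≤_ (sym dx) (sym dw) (n≤1+n 2))))
        where
        dx' : δ x' ≡ 2
        dx' = others x' (not-v gxx' x≢w) x'≢w
        x''≢w : x'' ≢ w
        x''≢w refl = [ not-v gxx' x≢w , [ (λ e → irr gxx' (sym e)) , x'≢y ]′ ]′ (nbr-of-w (gs gx'x''))

      gxy : G x y ≡ true
      gxy with another (G x) w (≤-reflexive (sym dx))
      ... | x' , gxx' , x'≢w with x' ≟ y
      ...   | yes refl = gxx'
      ...   | no x'≢y = ⊥-elim (no-detour gxx' x'≢w x'≢y)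

      gvx : G v x ≡ false
      gvx = non-adjacent (λ g → x≢w (nbr-of-v g))

      open Extend G sG v x (≢-sym x≢v) gvx

      -- H on v, w, x, y: the complete graph minus the edge vy.
      A : Fin 4 → Fin 4 → Bool
      A zero (suc (suc (suc zero))) = false
      A (suc (suc (suc zero))) zero = false
      A _ _ = true
      D : Fin 4 → ℕ
      D zero = 2
      D (suc zero) = 3
      D (suc (suc zero)) = 3
      D (suc (suc (suc zero))) = 2
      lab : Fin 4 → Fin n
      lab zero = v
      lab (suc zero) = w
      lab (suc (suc zero)) = x
      lab (suc (suc (suc zero))) = y

      H-nbr-of-v : ∀ {z} → H v z ≡ true → z ≡ w ⊎ z ≡ x
      H-nbr-of-v {z} h = [ (λ g → inj₁ (nbr-of-v g)) , inj₂ ]′ (nbr-u z h)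
      not-vy : ¬ (H v y ≡ true)
      not-vy h = [ y≢w , y≢x ]′ (H-nbr-of-v h)
      edges-in-A : ∀ i j → H (lab i) (lab j) ≡ true → A i j ≡ true
      edges-in-A zero (suc (suc (suc zero))) h = ⊥-elim (not-vy h)
      edges-in-A (suc (suc (suc zero))) zero h = ⊥-elim (not-vy (trans (H-sym v y) h))
      edges-in-A zero zero _ = refl
      edges-in-A zero (suc zero) _ = refl
      edges-in-A zero (suc (suc zero)) _ = refl
      edges-in-A (suc zero) _ _ = refl
      edges-in-A (suc (suc zero)) _ _ = refl
      edges-in-A (suc (suc (suc zero))) (suc zero) _ = refl
      edges-in-A (suc (suc (suc zero))) (suc (suc zero)) _ = refl
      edges-in-A (suc (suc (suc zero))) (suc (suc (suc zero))) _ = refl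
      degrees : ∀ i → deg H (lab i) ≡ D i
      degrees zero = trans deg-u (cong suc dv)
      degrees (suc zero) = trans (deg-other w (λ e → irr gvw (sym e)) (≢-sym x≢w)) dw
      degrees (suc (suc zero)) = trans deg-v (cong suc dx)
      degrees (suc (suc (suc zero))) = trans (deg-other y y≢v y≢x) dy
      closed : ∀ i z → H (lab i) z ≡ true → Σ (Fin 4) λ j → lab j ≡ z
      closed zero z h = [ (λ e → # 1 , sym e) , (λ e → # 2 , sym e) ]′ (H-nbr-of-v h)
      closed (suc zero) z h = [ (λ e → # 0 , sym e) , [ (λ e → # 2 , sym e) , (λ e → # 3 , sym e) ]′ ]′
                                (nbr-of-w (nbr-other w z (λ e → irr gvw (sym e)) (≢-sym x≢w) h))
      closed (suc (suc zero)) z h =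
        [ (λ g → [ (λ e → # 1 , sym e) , (λ e → # 3 , sym e) ]′ (only2 (G x) (≤-reflexive dx) (gs gwx) gxy (≢-sym y≢w) g))
        , (λ e → # 0 , sym e) ]′ (nbr-v z h)
      closed (suc (suc (suc zero))) z h =
        [ (λ e → # 1 , sym e) , (λ e → # 2 , sym e) ]′ (only2 (G y) (≤-reflexive dy) (gs gwy) (gs gxy) (≢-sym x≢w) (nbr-other y z y≢v y≢x h))

      contradiction : ⊥
      contradiction = Locally.refute v x (≢-sym x≢v) gvx lab A D edges-in-A degrees refl closed (# 0 , refl) (# 2 , refl)

  -- Global consequences when n ≥ 3, i.e. any two vertices miss a third one: there is at
  -- most one leaf, its neighbour is the unique vertex of maximum degree, and the degree
  -- sum exceeds 2n unless G is 2-regular.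
  module Global {n} (G : Graph n) (sG : IsSimple G) (none : NoMonotone4 G) (sat : Saturated4 G)
    (third-vertex : ∀ (v w : Fin n) → Σ (Fin n) λ z → z ≢ v × z ≢ w) where
    open Structure G sG none sat

    no-isolated : ∀ z → 1 ≤ δ z
    no-isolated z with δ z in e | third-vertex z z
    ... | suc _ | _ = s≤s z≤n
    ... | zero | w , w≢z , _ = ⊥-elim (NoIsolated.contradiction z w w≢z e)

    hub≥3 : ∀ {v w} → δ v ≡ 1 → G v w ≡ true → 3 ≤ δ w
    hub≥3 {v} {w} dv gvw with one-two-more (deg≥1 (gs gvw)) | third-vertex v w
    ... | inj₁ dw | z , z≢v , z≢w = ⊥-elim (NoK2.contradiction v w z dv gvw dw z≢v z≢w)
    ... | inj₂ (inj₁ dw) | _ = ⊥-elim (leaf-not-on-deg2 v w dv gvw dw)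
    ... | inj₂ (inj₂ dw≥3) | _ = dw≥3

    max-vertex : Fin n → Σ (Fin n) λ m → ∀ y → δ y ≤ δ m
    max-vertex x with max-outside δ [] {x} (λ ())
    ... | m , _ , m-max = m , λ y → m-max y (λ ())

    hub-is-max : ∀ {v w m} → δ v ≡ 1 → G v w ≡ true → (∀ y → δ y ≤ δ m) → m ≡ w
    hub-is-max {v} {w} {m} dv gvw m-max with m ≟ w
    ... | yes m≡w = m≡w
    ... | no m≢w = ⊥-elim (LeafSeesMax.contradiction v w m dv gvw (hub≥3 dv gvw) m-max m≢w)

    hub-strict-max : ∀ {v w} → δ v ≡ 1 → G v w ≡ true → ∀ z → z ≢ w → δ z < δ w
    hub-strict-max {v} {w} dv gvw z z≢w with max-vertex v
    ... | m , m-max with hub-is-max dv gvw m-max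
    ...   | refl with δ m ≤? δ z
    ...     | no m≰z = ≰⇒> m≰z
    ...     | yes m≤z = ⊥-elim (z≢w (hub-is-max dv gvw (λ y → ≤-trans (m-max y) m≤z)))

    unique-leaf : ∀ {v w} → δ v ≡ 1 → G v w ≡ true → ∀ v' → v' ≢ v → δ v' ≢ 1
    unique-leaf {v} {w} dv gvw v' v'≢v dv' with witness (G v') (≤-reflexive (sym dv'))
    ... | w' , gv'w' with w' ≟ w
    ...   | yes refl = TwoLeaves.contradiction v v' w (≢-sym v'≢v) dv dv' gvw gv'w' (hub≥3 dv gvw) (hub-strict-max dv gvw)
    ...   | no w'≢w = w'≢w (sym (hub-is-max dv' gv'w' w-max))
      where
      w-max : ∀ y → δ y ≤ δ w
      w-max y with y ≟ w
      ... | yes refl = ≤-refl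
      ... | no y≢w = <⇒≤ (hub-strict-max dv gvw y y≢w)

    deg≥2-except : ∀ {v w} → δ v ≡ 1 → G v w ≡ true → ∀ z → z ≢ v → 2 ≤ δ z
    deg≥2-except dv gvw z z≢v with one-two-more (no-isolated z)
    ... | inj₁ dz = ⊥-elim (unique-leaf dv gvw z z≢v dz)
    ... | inj₂ (inj₁ dz) = ≤-reflexive (sym dz)
    ... | inj₂ (inj₂ dz≥3) = ≤-trans (n≤1+n 2) dz≥3

    -- With a leaf v on w, the degree sum is at least 2n + 1: padding the leaf to degree 2,
    -- there are two units of excess, since either δ w ≥ 4 or some third vertex has degree ≥ 3
    -- (otherwise G contains the paw).
    module LeafDegreeSum (v w : Fin n) (dv : δ v ≡ 1) (gvw : G v w ≡ true) where
      pad : ∀ p q → p ≢ v → q ≢ v → (p ≡ q → 4 ≤ δ p) → 3 ≤ δ p → 3 ≤ δ q →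
        ∀ i → 2 + (ind ⌊ i ≟ p ⌋ + ind ⌊ i ≟ q ⌋) ≤ δ i + ind ⌊ i ≟ v ⌋
      pad p q p≢v q≢v same dp dq i with i ≟ p | i ≟ q | i ≟ v
      ... | yes refl | _ | yes refl = ⊥-elim (p≢v refl)
      ... | _ | yes refl | yes refl = ⊥-elim (q≢v refl)
      ... | yes refl | yes refl | no _ = ≤-trans (same refl) (m≤m+n (δ i) 0)
      ... | yes refl | no _ | no _ = ≤-trans dp (m≤m+n (δ i) 0)
      ... | no _ | yes refl | no _ = ≤-trans dq (m≤m+n (δ i) 0)
      ... | no _ | no _ | yes refl = ≤-reflexive (cong (_+ 1) (sym dv))
      ... | no _ | no _ | no i≢v = ≤-trans (deg≥2-except dv gvw i i≢v) (m≤m+n (δ i) 0)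

      excess₂ : ∀ p q → p ≢ v → q ≢ v → (p ≡ q → 4 ≤ δ p) → 3 ≤ δ p → 3 ≤ δ q → suc (n * 2) ≤ ΣF δ
      excess₂ p q p≢v q≢v same dp dq = +-cancelʳ-≤ 1 (suc (n * 2)) (ΣF δ) (begin
          suc (n * 2) + 1                                       ≡⟨ sym (+-suc (n * 2) 1) ⟩
          n * 2 + 2                                             ≡⟨ cong (n * 2 +_) (sym two-points) ⟩
          n * 2 + ΣF (λ i → ind ⌊ i ≟ p ⌋ + ind ⌊ i ≟ q ⌋)        ≤⟨ ΣF-lower (pad p q p≢v q≢v same dp dq) ⟩
          ΣF (λ i → δ i + ind ⌊ i ≟ v ⌋)                         ≡⟨ trans (ΣF-+ δ _) (cong (ΣF δ +_) (ΣF-point v)) ⟩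
          ΣF δ + 1                                              ∎)
        where
        open ≤-Reasoning
        two-points : ΣF (λ i → ind ⌊ i ≟ p ⌋ + ind ⌊ i ≟ q ⌋) ≡ 2
        two-points = trans (ΣF-+ (λ i → ind ⌊ i ≟ p ⌋) (λ i → ind ⌊ i ≟ q ⌋)) (cong₂ _+_ (ΣF-point p) (ΣF-point q))

      w≢v : w ≢ v
      w≢v e = irr gvw (sym e)

      -- Without excess beyond the hub of degree 3, the component of v is the paw.
      no-paw : δ w ≡ 3 → (∀ z → z ≢ v → z ≢ w → δ z ≡ 2) → ⊥
      no-paw dw others with another (G w) v (≤-trans (n≤1+n 2) (≤-reflexive (sym dw)))
      ... | x , gwx , x≢v with third (G w) v x (≤-reflexive (sym dw))
      ...   | y , gwy , y≢v , y≢x = Paw.contradiction v w x y dv gvw dw gwx gwy x≢v y≢v y≢x others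

      bound : suc (n * 2) ≤ ΣF δ
      bound with 4 ≤? δ w | any? (λ z → ¬? (z ≟ v) ×-dec ¬? (z ≟ w) ×-dec (3 ≤? δ z))
      ... | yes dw≥4 | _ = excess₂ w w w≢v w≢v (λ _ → dw≥4) (hub≥3 dv gvw) (hub≥3 dv gvw)
      ... | no _ | yes (z , z≢v , z≢w , dz≥3) = excess₂ w z w≢v z≢v (λ e → ⊥-elim (z≢w (sym e))) (hub≥3 dv gvw) dz≥3
      ... | no dw≱4 | no no-excess = ⊥-elim (no-paw (≤-antisym (s≤s⁻¹ (≰⇒> dw≱4)) (hub≥3 dv gvw)) others)
        where
        others : ∀ z → z ≢ v → z ≢ w → δ z ≡ 2
        others z z≢v z≢w with 3 ≤? δ z
        ... | yes dz≥3 = ⊥-elim (no-excess (z , z≢v , z≢w , dz≥3))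
        ... | no dz≱3 = ≤-antisym (s≤s⁻¹ (≰⇒> dz≱3)) (deg≥2-except dv gvw z z≢v)

    degree-2-or-more : ¬ (Σ (Fin n) λ z → δ z ≡ 1) → ∀ z → δ z ≡ 2 ⊎ 3 ≤ δ z
    degree-2-or-more no-leaf z with one-two-more (no-isolated z)
    ... | inj₁ dz = ⊥-elim (no-leaf (z , dz))
    ... | inj₂ d = d

    degree-sum : suc (n * 2) ≤ ΣF δ ⊎ (∀ z → δ z ≡ 2)
    degree-sum with any? (λ z → δ z ≟ℕ 1)
    ... | yes (v , dv) with witness (G v) (≤-reflexive (sym dv))
    ...   | w , gvw = inj₁ (LeafDegreeSum.bound v w dv gvw)
    degree-sum | no no-leaf with any? (λ z → 3 ≤? δ z)
    ... | yes (p , dp≥3) = inj₁ (subst (_≤ ΣF δ) (trans (cong (n * 2 +_) (ΣF-point p)) (+-comm (n * 2) 1)) (ΣF-lower pointwise))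
      where
      pointwise : ∀ i → 2 + ind ⌊ i ≟ p ⌋ ≤ δ i
      pointwise i with i ≟ p | degree-2-or-more no-leaf i
      ... | yes refl | _ = dp≥3
      ... | no _ | inj₁ di = ≤-reflexive (sym di)
      ... | no _ | inj₂ di≥3 = ≤-trans (n≤1+n 2) di≥3
    ... | no no-high = inj₂ λ z → [ (λ dz → dz) , (λ dz≥3 → ⊥-elim (no-high (z , dz≥3))) ]′ (degree-2-or-more no-leaf z)

module TwoRegular where

  open Counting
  open MonotonePaths

  -- The first point where a Boolean predicate holds (or the extra point fromℕ n if none).
  first : ∀ {n} → (Fin n → Bool) → Fin (suc n)
  first {zero} f = zero
  first {suc n} f = if f zero then zero else suc (first (λ i → f (suc i)))

  first-ext : ∀ {n} {f g : Fin n → Bool} → (∀ z → f z ≡ g z) → first f ≡ first g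
  first-ext {zero} e = refl
  first-ext {suc n} {f} {g} e rewrite e zero | first-ext {f = λ i → f (suc i)} {g = λ i → g (suc i)} (λ i → e (suc i)) = refl

  first-spec : ∀ {n} (f : Fin n → Bool) {j} → f j ≡ true → Σ (Fin n) λ x → first f ≡ inject₁ x × f x ≡ true
  first-spec {suc n} f {j} fj with f zero in e
  ... | true = zero , refl , e
  ... | false with j
  ...   | zero = ⊥-elim (true≢false (trans (sym fj) e))
  ...   | suc j' with first-spec (λ i → f (suc i)) fj
  ...     | x , p , q = suc x , cong suc p , q

  bool-ext : ∀ {a b : Bool} → (a ≡ true → b ≡ true) → (b ≡ true → a ≡ true) → a ≡ b
  bool-ext {true} {true} _ _ = refl
  bool-ext {false} {false} _ _ = refl
  bool-ext {true} {false} f _ = sym (f refl)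
  bool-ext {false} {true} _ g = g refl

  ΣF-multiple-of-3 : ∀ {n} (F : Fin n → ℕ) → (∀ m → F m ≡ 0 ⊎ F m ≡ 3) → Σ ℕ λ q → ΣF F ≡ q * 3
  ΣF-multiple-of-3 {zero} F h = 0 , refl
  ΣF-multiple-of-3 {suc n} F h with ΣF-multiple-of-3 (λ i → F (suc i)) (λ i → h (suc i)) | h zero
  ... | q , e | inj₁ z = q , cong₂ _+_ z e
  ... | q , e | inj₂ t = suc q , cong₂ _+_ t e

  -- A 2-regular simple graph without monotone path on four vertices is a disjoint union
  -- of triangles; hence its number of vertices is a multiple of 3.  Each vertex is mapped
  -- to the first vertex of its closed neighbourhood N[i], which is its triangle; every
  -- value of this map is taken 0 or 3 times.
  module DisjointTriangles {n} (G : Graph n) (sG : IsSimple G) (none : NoMonotone4 G) (reg : ∀ z → deg G z ≡ 2) where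
    gs : ∀ {x y} → G x y ≡ true → G y x ≡ true
    gs {x} {y} h = trans (proj₁ sG y x) h

    irr : ∀ {x y} → G x y ≡ true → x ≢ y
    irr {x} h refl = true≢false (trans (sym h) (proj₂ sG x))

    -- The two neighbours of a vertex are adjacent: otherwise a' a i b is a path of
    -- four vertices of degree 2, with a' the other neighbour of a.
    triangle : ∀ {i a b} → G i a ≡ true → G i b ≡ true → a ≢ b → G a b ≡ true
    triangle {i} {a} {b} gia gib a≢b with another (G a) i (≤-reflexive (sym (reg a)))
    ... | a' , gaa' , a'≢i with a' ≟ b
    ...   | yes refl = gaa'
    ...   | no a'≢b = ⊥-elim (none a' a i b (mkMonotone4 (≢-sym (irr gaa')) a'≢i a'≢b (≢-sym (irr gia)) a≢b (irr gib)
              (gs gaa') (gs gia) gib (inj₁ (≤-reflexive (trans (reg a') (sym (reg a))) , ≤-reflexive (trans (reg a) (sym (reg i)))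
                                           , ≤-reflexive (trans (reg i) (sym (reg b)))))))

    N : Fin n → Fin n → Bool
    N i z = G i z ∨ ⌊ z ≟ i ⌋

    N-self : ∀ i → N i i ≡ true
    N-self i with G i i | i ≟ i
    ... | true | _ = refl
    ... | false | yes _ = refl
    ... | false | no p = ⊥-elim (p refl)

    N-adj : ∀ {i z} → G i z ≡ true → N i z ≡ true
    N-adj g rewrite g = refl

    N-eq : ∀ {i z} → z ≡ i → N i z ≡ true
    N-eq refl = N-self _

    N-out : ∀ {i z} → N i z ≡ true → z ≡ i ⊎ G i z ≡ true
    N-out {i} {z} h with G i z | z ≟ i
    ... | true | _ = inj₂ refl
    ... | false | yes p = inj₁ p

    -- Closed neighbourhoods of adjacent vertices coincide (both are the common triangle).
    same-N : ∀ i j → N i j ≡ true → ∀ z → N i z ≡ N j z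
    same-N i j h z with N-out h
    ... | inj₁ refl = refl
    ... | inj₂ gij with another (G i) j (≤-reflexive (sym (reg i)))
    ...   | k , gik , k≢j = bool-ext forward backward
      where
      gjk : G j k ≡ true
      gjk = triangle gij gik (≢-sym k≢j)
      nbr-i : ∀ {y} → G i y ≡ true → y ≡ j ⊎ y ≡ k
      nbr-i = only2 (G i) (≤-reflexive (reg i)) gij gik (≢-sym k≢j)
      nbr-j : ∀ {y} → G j y ≡ true → y ≡ i ⊎ y ≡ k
      nbr-j = only2 (G j) (≤-reflexive (reg j)) (gs gij) gjk (irr gik)
      forward : N i z ≡ true → N j z ≡ true
      forward p with N-out p
      ... | inj₁ refl = N-adj (gs gij)
      ... | inj₂ g = [ N-eq , (λ e → N-adj (subst (λ t → G j t ≡ true) (sym e) gjk)) ]′ (nbr-i g)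
      backward : N j z ≡ true → N i z ≡ true
      backward p with N-out p
      ... | inj₁ refl = N-adj gij
      ... | inj₂ g = [ N-eq , (λ e → N-adj (subst (λ t → G i t ≡ true) (sym e) gik)) ]′ (nbr-j g)

    rep : Fin n → Fin (suc n)
    rep i = first (N i)

    rep-same : ∀ i j → N i j ≡ true → rep i ≡ rep j
    rep-same i j h = first-ext (same-N i j h)

    rep-back : ∀ i j → rep i ≡ rep j → N i j ≡ true
    rep-back i j e with first-spec (N i) (N-self i) | first-spec (N j) (N-self j)
    ... | x , px , nx | y , py , ny =
      trans (same-N i x nx j) (trans (cong (λ t → N t j) x≡y) (trans (sym (same-N j y ny j)) (N-self j)))
      where
      x≡y : x ≡ y
      x≡y = inject₁-injective (trans (sym px) (trans e py))

    class-size : Fin (suc n) → ℕ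
    class-size m = ΣF (λ i → ind ⌊ rep i ≟ m ⌋)

    class-size-0-or-3 : ∀ m → class-size m ≡ 0 ⊎ class-size m ≡ 3
    class-size-0-or-3 m with search (λ i → ⌊ rep i ≟ m ⌋)
    ... | inj₂ h = inj₁ (ΣF-zero (λ i → cong ind (h i)))
    ... | inj₁ (i₀ , e₀) = inj₂ (begin
          class-size m                    ≡⟨ ΣF-ext (λ z → cong ind (in-class z)) ⟩
          ΣF (λ z → ind (N i₀ z))          ≡⟨ sym (cnt≡ΣF (N i₀)) ⟩
          cnt (N i₀)                      ≡⟨ cnt-insert i₀ (G i₀) (proj₂ sG i₀) ⟩
          suc (deg G i₀)                  ≡⟨ cong suc (reg i₀) ⟩
          3                               ∎)
      where
      open ≡-Reasoning
      rep-i₀ : rep i₀ ≡ m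
      rep-i₀ with rep i₀ ≟ m
      ... | yes p = p
      ... | no _ = ⊥-elim (true≢false (sym e₀))
      in-class : ∀ z → ⌊ rep z ≟ m ⌋ ≡ N i₀ z
      in-class z = bool-ext forward backward
        where
        forward : ⌊ rep z ≟ m ⌋ ≡ true → N i₀ z ≡ true
        forward p with rep z ≟ m
        ... | yes q = rep-back i₀ z (trans rep-i₀ (sym q))
        backward : N i₀ z ≡ true → ⌊ rep z ≟ m ⌋ ≡ true
        backward p with rep z ≟ m
        ... | yes _ = refl
        ... | no q = ⊥-elim (q (trans (sym (rep-same i₀ z p)) rep-i₀))

    n≡Σclass-size : n ≡ ΣF class-size
    n≡Σclass-size = begin
        n                                              ≡⟨ sym (*-identityʳ n) ⟩
        n * 1                                          ≡⟨ sym (ΣF-const n 1) ⟩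
        ΣF {n} (λ _ → 1)                               ≡⟨ ΣF-ext (λ i → sym (one-class (rep i))) ⟩
        ΣF (λ i → ΣF (λ m → ind ⌊ rep i ≟ m ⌋))          ≡⟨ ΣF-swap (λ i m → ind ⌊ rep i ≟ m ⌋) ⟩
        ΣF class-size                                  ∎
      where
      open ≡-Reasoning
      one-class : ∀ {k} (a : Fin k) → ΣF (λ m → ind ⌊ a ≟ m ⌋) ≡ 1
      one-class a = trans (ΣF-ext (λ m → cong ind (≟-comm a m))) (ΣF-point a)

    multiple-of-3 : n % 3 ≡ 0
    multiple-of-3 with ΣF-multiple-of-3 class-size class-size-0-or-3
    ... | q , e = trans (cong (_% 3) (trans n≡Σclass-size e)) (m*n%n≡0 q 3)

module Union where

  open Counting
  open MonotonePaths

  module DisjointUnion {g m : ℕ} (A : Graph g) (B : Graph m) where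

    join : Fin g ⊎ Fin m → Fin g ⊎ Fin m → Bool
    join (inj₁ k) (inj₁ l) = A k l
    join (inj₂ x) (inj₂ y) = B x y
    join (inj₁ _) (inj₂ _) = false
    join (inj₂ _) (inj₁ _) = false

    U : Graph (g + m)
    U i j = join (splitAt g i) (splitAt g j)

    L : Fin g → Fin (g + m)
    L k = k ↑ˡ m

    R : Fin m → Fin (g + m)
    R x = g ↑ʳ x

    U-LL : ∀ k l → U (L k) (L l) ≡ A k l
    U-LL k l rewrite splitAt-↑ˡ g k m | splitAt-↑ˡ g l m = refl

    U-RR : ∀ x y → U (R x) (R y) ≡ B x y
    U-RR x y rewrite splitAt-↑ʳ g m x | splitAt-↑ʳ g m y = refl

    U-LR : ∀ k y → U (L k) (R y) ≡ false
    U-LR k y rewrite splitAt-↑ˡ g k m | splitAt-↑ʳ g m y = refl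

    U-RL : ∀ x l → U (R x) (L l) ≡ false
    U-RL x l rewrite splitAt-↑ʳ g m x | splitAt-↑ˡ g l m = refl

    side : ∀ i → (Σ (Fin g) λ k → L k ≡ i) ⊎ (Σ (Fin m) λ x → R x ≡ i)
    side i with splitAt g i in e
    ... | inj₁ k = inj₁ (k , splitAt⁻¹-↑ˡ e)
    ... | inj₂ x = inj₂ (x , splitAt⁻¹-↑ʳ e)

    L-injective : ∀ {k l} → L k ≡ L l → k ≡ l
    L-injective = ↑ˡ-injective m _ _

    R-injective : ∀ {x y} → R x ≡ R y → x ≡ y
    R-injective = ↑ʳ-injective g _ _

    stay-L : ∀ {k y} → U (L k) y ≡ true → Σ (Fin g) λ l → L l ≡ y
    stay-L {k} {y} h with side y
    ... | inj₁ p = p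
    ... | inj₂ (x , refl) = ⊥-elim (true≢false (trans (sym h) (U-LR k x)))

    stay-R : ∀ {x y} → U (R x) y ≡ true → Σ (Fin m) λ z → R z ≡ y
    stay-R {x} {y} h with side y
    ... | inj₂ p = p
    ... | inj₁ (l , refl) = ⊥-elim (true≢false (trans (sym h) (U-RL x l)))

    deg-L : ∀ k → deg U (L k) ≡ deg A k
    deg-L k = begin
        deg U (L k)                                                  ≡⟨ cnt≡ΣF (U (L k)) ⟩
        ΣF (λ j → ind (U (L k) j))                                   ≡⟨ ΣF-split g m (λ j → ind (U (L k) j)) ⟩
        ΣF (λ l → ind (U (L k) (L l))) + ΣF (λ y → ind (U (L k) (R y))) ≡⟨ cong₂ _+_ (ΣF-ext (λ l → cong ind (U-LL k l)))
                                                                                    (ΣF-zero (λ y → cong ind (U-LR k y))) ⟩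
        ΣF (λ l → ind (A k l)) + 0                                   ≡⟨ +-identityʳ _ ⟩
        ΣF (λ l → ind (A k l))                                       ≡⟨ sym (cnt≡ΣF (A k)) ⟩
        deg A k                                                      ∎
      where open ≡-Reasoning

    deg-R : ∀ x → deg U (R x) ≡ deg B x
    deg-R x = begin
        deg U (R x)                                                  ≡⟨ cnt≡ΣF (U (R x)) ⟩
        ΣF (λ j → ind (U (R x) j))                                   ≡⟨ ΣF-split g m (λ j → ind (U (R x) j)) ⟩
        ΣF (λ l → ind (U (R x) (L l))) + ΣF (λ y → ind (U (R x) (R y))) ≡⟨ cong₂ _+_ (ΣF-zero (λ l → cong ind (U-RL x l)))
                                                                                    (ΣF-ext (λ y → cong ind (U-RR x y))) ⟩
        ΣF (λ y → ind (B x y))                                       ≡⟨ sym (cnt≡ΣF (B x)) ⟩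
        deg B x                                                      ∎
      where open ≡-Reasoning

    ΣF-deg : ΣF (deg U) ≡ ΣF (deg A) + ΣF (deg B)
    ΣF-deg = trans (ΣF-split g m (deg U)) (cong₂ _+_ (ΣF-ext deg-L) (ΣF-ext deg-R))

    simple : IsSimple A → IsSimple B → IsSimple U
    simple (symA , irrA) (symB , irrB) = symmetric , irreflexive
      where
      symmetric : ∀ i j → U i j ≡ U j i
      symmetric i j with side i | side j
      ... | inj₁ (k , refl) | inj₁ (l , refl) = trans (U-LL k l) (trans (symA k l) (sym (U-LL l k)))
      ... | inj₁ (k , refl) | inj₂ (y , refl) = trans (U-LR k y) (sym (U-RL y k))
      ... | inj₂ (x , refl) | inj₁ (l , refl) = trans (U-RL x l) (sym (U-LR l x))
      ... | inj₂ (x , refl) | inj₂ (y , refl) = trans (U-RR x y) (trans (symB x y) (sym (U-RR y x)))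
      irreflexive : ∀ i → U i i ≡ false
      irreflexive i with side i
      ... | inj₁ (k , refl) = trans (U-LL k k) (irrA k)
      ... | inj₂ (x , refl) = trans (U-RR x x) (irrB x)

    -- A path of U stays in one part, where it is a path with the same degrees.
    no-monotone : NoMonotone4 A → NoMonotone4 B → NoMonotone4 U
    no-monotone noA noB a b c d path with side a
    ... | inj₁ (k , refl) with stay-L (Monotone4.eab path)
    ...   | l , refl with stay-L (Monotone4.ebc path)
    ...     | o , refl with stay-L (Monotone4.ecd path)
    ...       | p , refl = noA k l o p (pullback4 L L-injective (λ i j h → trans (sym (U-LL i j)) h) deg-L path)
    no-monotone noA noB a b c d path | inj₂ (x , refl) with stay-R (Monotone4.eab path)
    ...   | y , refl with stay-R (Monotone4.ebc path)
    ...     | z , refl with stay-R (Monotone4.ecd path)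
    ...       | t , refl = noB x y z t (pullback4 R R-injective (λ i j h → trans (sym (U-RR i j)) h) deg-R path)

module Construction where

  open Counting
  open MonotonePaths
  open AddEdge
  open Handshake
  open LocalCheck
  open Union

  -- The cyclic successor on Fin 3; the two other elements of r are next r and next (next r).
  next : Fin 3 → Fin 3
  next zero = suc zero
  next (suc zero) = suc (suc zero)
  next (suc (suc zero)) = zero

  next≢ : ∀ r → next r ≢ r
  next≢ zero ()
  next≢ (suc zero) ()
  next≢ (suc (suc zero)) ()

  next²≢ : ∀ r → next (next r) ≢ r
  next²≢ zero ()
  next²≢ (suc zero) ()
  next²≢ (suc (suc zero)) ()

  next≢next² : ∀ r → next r ≢ next (next r)
  next≢next² zero ()
  next≢next² (suc zero) ()
  next≢next² (suc (suc zero)) ()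

  other-places : ∀ r s → s ≢ r → s ≡ next r ⊎ s ≡ next (next r)
  other-places zero zero ne = ⊥-elim (ne refl)
  other-places zero (suc zero) _ = inj₁ refl
  other-places zero (suc (suc zero)) _ = inj₂ refl
  other-places (suc zero) zero _ = inj₂ refl
  other-places (suc zero) (suc zero) ne = ⊥-elim (ne refl)
  other-places (suc zero) (suc (suc zero)) _ = inj₁ refl
  other-places (suc (suc zero)) zero _ = inj₁ refl
  other-places (suc (suc zero)) (suc zero) _ = inj₂ refl
  other-places (suc (suc zero)) (suc (suc zero)) ne = ⊥-elim (ne refl)

  -- q disjoint triangles on Fin (q * 3): vertex x lies in block `block x` at place
  -- `place x`, and two vertices are adjacent when they are distinct and in the same block.
  module Triangles (q : ℕ) where

    block : Fin (q * 3) → Fin q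
    block = quotient 3

    place : Fin (q * 3) → Fin 3
    place = remainder {q} 3

    block-combine : ∀ t r → block (combine t r) ≡ t
    block-combine t r = cong proj₁ (remQuot-combine t r)

    combine-block-place : ∀ x → combine (block x) (place x) ≡ x
    combine-block-place x = combine-remQuot {q} 3 x

    Δ : Graph (q * 3)
    Δ x y = ⌊ block x ≟ block y ⌋ ∧ not ⌊ x ≟ y ⌋

    Δ-intro : ∀ {x y} → block x ≡ block y → x ≢ y → Δ x y ≡ true
    Δ-intro {x} {y} b x≢y with block x ≟ block y | x ≟ y
    ... | yes _ | no _ = refl
    ... | no ne | _ = ⊥-elim (ne b)
    ... | yes _ | yes e = ⊥-elim (x≢y e)

    Δ-elim : ∀ {x y} → Δ x y ≡ true → block x ≡ block y × x ≢ y
    Δ-elim {x} {y} h with block x ≟ block y | x ≟ y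
    ... | yes b | no x≢y = b , x≢y

    simple : IsSimple Δ
    simple = (λ x y → cong₂ _∧_ (≟-comm (block x) (block y)) (cong not (≟-comm x y))) , irreflexive
      where
      irreflexive : ∀ x → Δ x x ≡ false
      irreflexive x with x ≟ x
      ... | yes _ = ∧-zeroʳ _
      ... | no ne = ⊥-elim (ne refl)

    p₁ p₂ : Fin (q * 3) → Fin (q * 3)
    p₁ x = combine (block x) (next (place x))
    p₂ x = combine (block x) (next (next (place x)))

    apart : ∀ t r s → r ≢ s → combine {q} {3} t r ≢ combine t s
    apart t r s r≢s e = r≢s (combine-injectiveʳ t r t s e)

    p₁-apart : ∀ x → x ≢ p₁ x
    p₁-apart x e = apart (block x) (place x) (next (place x)) (≢-sym (next≢ (place x))) (trans (combine-block-place x) e)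

    p₂-apart : ∀ x → x ≢ p₂ x
    p₂-apart x e = apart (block x) (place x) (next (next (place x))) (≢-sym (next²≢ (place x))) (trans (combine-block-place x) e)

    p₁-block : ∀ x → block (p₁ x) ≡ block x
    p₁-block x = block-combine (block x) _

    p₂-block : ∀ x → block (p₂ x) ≡ block x
    p₂-block x = block-combine (block x) _

    p₁≢p₂ : ∀ x → p₁ x ≢ p₂ x
    p₁≢p₂ x = apart (block x) _ _ (next≢next² (place x))

    Δ-p₁ : ∀ x → Δ x (p₁ x) ≡ true
    Δ-p₁ x = Δ-intro (sym (p₁-block x)) (p₁-apart x)

    Δ-p₂ : ∀ x → Δ x (p₂ x) ≡ true
    Δ-p₂ x = Δ-intro (sym (p₂-block x)) (p₂-apart x)

    Δ-p₁p₂ : ∀ x → Δ (p₁ x) (p₂ x) ≡ true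
    Δ-p₁p₂ x = Δ-intro (trans (p₁-block x) (sym (p₂-block x))) (p₁≢p₂ x)

    Δ-nbr : ∀ {x y} → Δ x y ≡ true → y ≡ p₁ x ⊎ y ≡ p₂ x
    Δ-nbr {x} {y} h with Δ-elim h
    ... | b , x≢y = [ (λ e → inj₁ (at e)) , (λ e → inj₂ (at e)) ]′ (other-places (place x) (place y) place≢)
      where
      at : ∀ {r} → place y ≡ r → y ≡ combine (block x) r
      at refl = trans (sym (combine-block-place y)) (cong (λ t → combine t (place y)) (sym b))
      place≢ : place y ≢ place x
      place≢ e = x≢y (trans (sym (combine-block-place x)) (trans (cong (combine (block x)) (sym e)) (sym (at refl))))

    deg-Δ : ∀ x → deg Δ x ≡ 2
    deg-Δ x = ≤-antisym (cnt≤length (Δ x) within)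
                        (distinct≤cnt (Δ x) ((p₁≢p₂ x ∷ []) ∷ [] ∷ []) (Δ-p₁ x ∷ Δ-p₂ x ∷ []))
      where
      within : ∀ y → Δ x y ≡ true → y ∈ p₁ x ∷ p₂ x ∷ []
      within y h = [ here , there ∘ here ]′ (Δ-nbr h)

    -- A path a b c d would need a fourth vertex d adjacent to c besides a and b.
    no-monotone : NoMonotone4 Δ
    no-monotone a b c d (mkMonotone4 dab dac dad dbc dbd dcd eab ebc ecd _) =
      [ dbd ∘ sym , dad ∘ sym ]′ (only2 (Δ c) (≤-reflexive (deg-Δ c)) (trans (proj₁ simple c b) ebc) tca (≢-sym dab) ecd)
      where
      tca : Δ c a ≡ true
      tca = Δ-intro (sym (trans (proj₁ (Δ-elim eab)) (proj₁ (Δ-elim ebc)))) (≢-sym dac)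

  -- A new edge from a triangle vertex x to any j extends the path p₁ p₂ x
  -- of degrees 2, 2, 3 (as deg j + 1 ≥ 3); a new edge inside A lifts the path it creates in A.
  module WithTriangles {g : ℕ} (q : ℕ) (A : Graph g) (sA : IsSimple A) (min2 : ∀ k → 2 ≤ deg A k)
    (noA : NoMonotone4 A) (satA : Saturated4 A) where
    open Triangles q using (Δ; p₁; p₂; Δ-p₁; Δ-p₂; Δ-p₁p₂; p₁-apart; p₂-apart; p₁≢p₂; deg-Δ)
      renaming (simple to Δ-simple; no-monotone to Δ-no-monotone)
    open DisjointUnion A Δ

    G : Graph (g + q * 3)
    G = U

    sG : IsSimple G
    sG = simple sA Δ-simple

    noG : NoMonotone4 G
    noG = no-monotone noA Δ-no-monotone

    deg≥2 : ∀ i → 2 ≤ deg G i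
    deg≥2 i with side i
    ... | inj₁ (k , refl) = subst (2 ≤_) (sym (deg-L k)) (min2 k)
    ... | inj₂ (x , refl) = ≤-reflexive (sym (trans (deg-R x) (deg-Δ x)))

    triangle-path : ∀ x j (ne : R x ≢ j) (gf : G (R x) j ≡ false) →
      Monotone4 (addEdge G (R x) j) (R (p₁ x)) (R (p₂ x)) (R x) j
    triangle-path x j ne gf =
      mkMonotone4 (R-apart (p₁≢p₂ x)) (≢-sym (R-apart (p₁-apart x))) (away (Δ-p₁ x))
                  (≢-sym (R-apart (p₂-apart x))) (away (Δ-p₂ x)) ne
                  (G⊆H _ _ (trans (U-RR _ _) (Δ-p₁p₂ x))) (G⊆H _ _ (trans (U-RR _ _) (trans (proj₁ Δ-simple _ _) (Δ-p₂ x)))) H-uv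
                  (inj₁ (≤-reflexive (trans (deg-two p₁ (p₁-apart x) (Δ-p₁ x)) (sym (deg-two p₂ (p₂-apart x) (Δ-p₂ x))))
                        , subst₂ _≤_ (sym (deg-two p₂ (p₂-apart x) (Δ-p₂ x))) (sym deg-x) (n≤1+n 2)
                        , subst (_≤ deg H j) (sym deg-x) (subst (3 ≤_) (sym deg-v) (s≤s (deg≥2 j)))))
      where
      open Extend G sG (R x) j ne gf
      R-apart : ∀ {y z} → y ≢ z → R y ≢ R z
      R-apart y≢z e = y≢z (R-injective e)
      away : ∀ {y} → Δ x y ≡ true → R y ≢ j
      away {y} h refl = true≢false (trans (sym (trans (U-RR x y) h)) gf)
      deg-x : deg H (R x) ≡ 3
      deg-x = trans deg-u (cong suc (trans (deg-R x) (deg-Δ x)))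
      deg-two : ∀ (p : Fin (q * 3) → Fin (q * 3)) → x ≢ p x → Δ x (p x) ≡ true → deg H (R (p x)) ≡ 2
      deg-two p x≢p h = trans (deg-other (R (p x)) (≢-sym (R-apart x≢p)) (away h)) (trans (deg-R (p x)) (deg-Δ (p x)))

    gadget-path : ∀ s t → s ≢ t → A s t ≡ false → HasMonotone4 (addEdge G (L s) (L t))
    gadget-path s t s≢t ast with satA s t s≢t ast
    ... | a , b , c , d , path = L a , L b , L c , L d , pushforward4 L L-injective adjacent degrees path
      where
      module ExtA = Extend A sA s t s≢t ast
      module ExtG = Extend G sG (L s) (L t) (λ e → s≢t (L-injective e)) (trans (U-LL s t) ast)
      adjacent : ∀ i j → addEdge A s t i j ≡ true → addEdge G (L s) (L t) (L i) (L j) ≡ true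
      adjacent i j h with ExtA.H⊆G∪new i j h
      ... | inj₁ aij = ExtG.G⊆H (L i) (L j) (trans (U-LL i j) aij)
      ... | inj₂ (inj₁ (refl , refl)) = ExtG.H-uv
      ... | inj₂ (inj₂ (refl , refl)) = ExtG.H-vu
      degrees : ∀ i → deg (addEdge G (L s) (L t)) (L i) ≡ deg (addEdge A s t) i
      degrees i with ExtA.position i
      ... | inj₁ refl = trans ExtG.deg-u (trans (cong suc (deg-L s)) (sym ExtA.deg-u))
      ... | inj₂ (inj₁ refl) = trans ExtG.deg-v (trans (cong suc (deg-L t)) (sym ExtA.deg-v))
      ... | inj₂ (inj₂ (i≢s , i≢t)) = trans (ExtG.deg-other (L i) (λ e → i≢s (L-injective e)) (λ e → i≢t (L-injective e)))
                                            (trans (deg-L i) (sym (ExtA.deg-other i i≢s i≢t)))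

    satG : Saturated4 G
    satG u v u≢v guv with side u | side v
    ... | inj₂ (x , refl) | _ = _ , _ , _ , _ , triangle-path x v u≢v guv
    ... | inj₁ (k , refl) | inj₂ (y , refl) =
      _ , _ , _ , _ , Monotone4-ext (addEdge-comm G (R y) (L k)) (triangle-path y (L k) (≢-sym u≢v) (trans (proj₁ sG (R y) (L k)) guv))
    ... | inj₁ (k , refl) | inj₁ (l , refl) = gadget-path k l (λ e → u≢v (cong L e)) (trans (sym (U-LL k l)) guv)

    saturated : IsSaturated 4 G
    saturated = ⇒IsSaturated sG noG satG

    edge-count : ∀ c → ΣF (deg A) ≡ c + c → edges G ≡ c + q * 3
    edge-count c hA = double-injective (begin
        edges G + edges G                       ≡⟨ sym (handshake G sG) ⟩
        ΣF (deg G)                              ≡⟨ ΣF-deg ⟩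
        ΣF (deg A) + ΣF (deg Δ)                 ≡⟨ cong₂ _+_ hA (trans (ΣF-ext deg-Δ) (trans (ΣF-const (q * 3) 2) (twice (q * 3)))) ⟩
        (c + c) + (q * 3 + q * 3)               ≡⟨ interchange c c (q * 3) (q * 3) ⟩
        (c + q * 3) + (c + q * 3)               ∎)
      where open ≡-Reasoning

  module Verified {g : ℕ} (A : Graph g)
    (symmetric : every (λ k → every (λ l → ⌊ A k l ≟ᵇ A l k ⌋)) ≡ true)
    (loopless : every (λ k → not (A k k)) ≡ true)
    (min-degree : every (λ k → 2 ≤ᵇ deg A k) ≡ true)
    (path-free : SmallGraph.noPath4 A (deg A) ≡ true)
    (saturating : every (λ s → every (λ t → ⌊ s ≟ t ⌋ ∨ A s t ∨ SmallGraph.somePath4 (addEdge A s t) (deg (addEdge A s t)))) ≡ true)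
    where

    sA : IsSimple A
    sA = (λ k l → ≟⇒≡ (every-sound (every-sound symmetric k) l)) , (λ k → not-true (every-sound loopless k))
      where
      ≟⇒≡ : ∀ {a b} → ⌊ a ≟ᵇ b ⌋ ≡ true → a ≡ b
      ≟⇒≡ {a} {b} h with a ≟ᵇ b
      ... | yes p = p
      not-true : ∀ {b} → not b ≡ true → b ≡ false
      not-true {false} _ = refl

    min2 : ∀ k → 2 ≤ deg A k
    min2 k = ≤ᵇ⇒≤ 2 (deg A k) (≡⇒T (every-sound min-degree k))

    noA : NoMonotone4 A
    noA = Computed.noPath4⇒NoMonotone4 A path-free

    satA : Saturated4 A
    satA s t s≢t ast = Computed.somePath4⇒HasMonotone4 (addEdge A s t)
                          (or-false ast (or-false distinct (every-sound (every-sound saturating s) t)))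
      where
      or-false : ∀ {a b} → a ≡ false → a ∨ b ≡ true → b ≡ true
      or-false refl h = h
      distinct : ⌊ s ≟ t ⌋ ≡ false
      distinct with s ≟ t
      ... | yes e = ⊥-elim (s≢t e)
      ... | no _ = refl

  fromEdges : ∀ {g} → List (ℕ × ℕ) → Graph g
  fromEdges es k l = any (λ e → ((toℕ k ≡ᵇ proj₁ e) ∧ (toℕ l ≡ᵇ proj₂ e)) ∨ ((toℕ k ≡ᵇ proj₂ e) ∧ (toℕ l ≡ᵇ proj₁ e))) es

  empty : Graph 0
  empty = fromEdges []

  diamond : Graph 4
  diamond = fromEdges ((0 , 1) ∷ (0 , 2) ∷ (0 , 3) ∷ (1 , 2) ∷ (1 , 3) ∷ [])

  bowtie : Graph 5
  bowtie = fromEdges ((0 , 1) ∷ (0 , 2) ∷ (1 , 2) ∷ (0 , 3) ∷ (0 , 4) ∷ (3 , 4) ∷ [])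

  module Empty = Verified empty refl refl refl refl refl
  module Diamond = Verified diamond refl refl refl refl refl
  module Bowtie = Verified bowtie refl refl refl refl refl

open Counting
open MonotonePaths
open Handshake
open LowerBound
open TwoRegular
open Construction

third-vertex : ∀ {k} (v w : Fin (3 + k)) → Σ (Fin (3 + k)) λ z → z ≢ v × z ≢ w
third-vertex zero zero = suc zero , (λ ()) , (λ ())
third-vertex zero (suc zero) = suc (suc zero) , (λ ()) , (λ ())
third-vertex zero (suc (suc w)) = suc zero , (λ ()) , (λ ())
third-vertex (suc zero) zero = suc (suc zero) , (λ ()) , (λ ())
third-vertex (suc (suc v)) zero = suc zero , (λ ()) , (λ ())
third-vertex (suc v) (suc w) = zero , (λ ()) , (λ ())

lower-bound : ∀ k (G : Graph (3 + k)) → IsSaturated 4 G → (4 + k ≤ edges G) ⊎ (3 + k ≤ edges G × (3 + k) % 3 ≡ 0)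
lower-bound k G isSat with IsSaturated⇒ isSat
... | sG , none , sat with Global.degree-sum G sG none sat third-vertex
...   | inj₁ excess = inj₁ (half< (subst ((3 + k) * 2 <_) (handshake G sG) excess))
...   | inj₂ regular = inj₂ (≤-reflexive (sym edges≡n) , DisjointTriangles.multiple-of-3 G sG none regular)
  where
  edges≡n : edges G ≡ 3 + k
  edges≡n = double-injective (begin
      edges G + edges G      ≡⟨ sym (handshake G sG) ⟩
      ΣF (deg G)            ≡⟨ ΣF-ext regular ⟩
      ΣF {3 + k} (λ _ → 2)  ≡⟨ ΣF-const (3 + k) 2 ⟩
      (3 + k) * 2           ≡⟨ twice (3 + k) ⟩
      (3 + k) + (3 + k)     ∎)
    where open ≡-Reasoning

Witness : ℕ → ℕ → Set
Witness N E = Σ (Graph N) λ G → IsSaturated 4 G × edges G ≡ E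

transport : ∀ {N N' E E'} → N ≡ N' → E ≡ E' → Witness N E → Witness N' E'
transport refl refl w = w

triangles : ∀ q → Witness (3 + q * 3) (3 + q * 3)
triangles q = G , saturated , edge-count 0 refl
  where open WithTriangles (suc q) empty Empty.sA Empty.min2 Empty.noA Empty.satA

diamond-and-triangles : ∀ q → Witness (4 + q * 3) (5 + q * 3)
diamond-and-triangles q = G , saturated , edge-count 5 refl
  where open WithTriangles q diamond Diamond.sA Diamond.min2 Diamond.noA Diamond.satA

bowtie-and-triangles : ∀ q → Witness (5 + q * 3) (6 + q * 3)
bowtie-and-triangles q = G , saturated , edge-count 6 refl
  where open WithTriangles q bowtie Bowtie.sA Bowtie.min2 Bowtie.noA Bowtie.satA

decompose : ∀ k {r} → (3 + k) % 3 ≡ r → 3 + k ≡ 3 + (r + (k / 3) * 3)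
decompose k {r} e = cong (3 +_) (trans (m≡m%n+[m/n]*n k 3) (cong (_+ (k / 3) * 3) (trans (sym residue) e)))
  where
  residue : (3 + k) % 3 ≡ k % 3
  residue = trans (cong (_% 3) (+-comm 3 k)) ([m+n]%n≡m%n k 3)

successor : ∀ {m n} → m ≡ n → suc m ≡ n + 1
successor {n = n} refl = +-comm 1 n

nonzero-residue : ∀ {r} → r ≡ 1 ⊎ r ≡ 2 → r ≢ 0
nonzero-residue (inj₁ refl) ()
nonzero-residue (inj₂ refl) ()

theorem3p3 : ∀ (n : ℕ) → 3 ≤ n →
    (n % 3 ≡ 0 → IsH n 4 n) × ((n % 3 ≡ 1 ⊎ n % 3 ≡ 2) → IsH n 4 (n + 1))
theorem3p3 (suc zero) (s≤s ())
theorem3p3 (suc (suc zero)) (s≤s (s≤s ()))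
theorem3p3 (suc (suc (suc k))) _ = divisible , not-divisible
  where
  n : ℕ
  n = 3 + k

  divisible : n % 3 ≡ 0 → IsH n 4 n
  divisible r = transport (sym (decompose k r)) (sym (decompose k r)) (triangles (k / 3))
              , λ G s → [ ≤-trans (n≤1+n n) , proj₁ ]′ (lower-bound k G s)

  not-divisible : n % 3 ≡ 1 ⊎ n % 3 ≡ 2 → IsH n 4 (n + 1)
  not-divisible r = construction r , λ G s → [ subst (_≤ edges G) (+-comm 1 n) , (λ { (_ , z) → ⊥-elim (nonzero-residue r z) }) ]′
                                       (lower-bound k G s)
    where
    construction : n % 3 ≡ 1 ⊎ n % 3 ≡ 2 → Witness n (n + 1)
    construction (inj₁ r₁) = transport (sym (decompose k r₁)) (successor (sym (decompose k r₁))) (diamond-and-triangles (k / 3))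
    construction (inj₂ r₂) = transport (sym (decompose k r₂)) (successor (sym (decompose k r₂))) (bowtie-and-triangles (k / 3))
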